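{- For all positive integers $s$ and $t$, if $n_1=4st^2(2s^2+3s+1)$ and $n_2=t^2(2s^2-1)^2$, then the graph $K_{n_1,n_1}\odot\overline{K_{n_2}}$ is $A$-integral.
   Context: All graphs are finite, simple and undirected. $K_{n,n}$ is the complete bipartite graph with both parts of size $n$; $\overline{K_n}$ is the graph on $n$ vertices with no edges. A graph is $A$-integral if all eigenvalues of its adjacency matrix are integers. The subdivision graph $\mathcal{S}(G)$ is obtained from $G$ by inserting a new vertex into every edge of $G$. The subdivision-vertex corona $G_1\odot G_2$ of two vertex-disjoint graphs is the graph obtained from $\mathcal{S}(G_1)$ and $|V(G_1)|$ copies of $G_2$, all vertex-disjoint, by joining the $i$th vertex of $V(G_1)$ to every vertex in the $i$th copy of $G_2$. -}

module Defs where

open import Data.Nat using (ℕ; zero; suc; _+_; _*_)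
open import Data.Fin using (Fin; zero; suc; splitAt; remQuot; _↑ˡ_; _↑ʳ_; punchIn; _≟_)
open import Data.Bool using (Bool; true; false; if_then_else_; _∨_; _∧_)
open import Data.Integer using (ℤ; +_; -_) renaming (_+_ to _+ℤ_; _*_ to _*ℤ_; _-_ to _-ℤ_)
open import Data.Product using (_×_; _,_; proj₁; proj₂; Σ)
open import Data.Sum using (_⊎_; inj₁; inj₂)
open import Relation.Nullary using (does)
open import Relation.Binary.PropositionalEquality using (_≡_)

sumFin : ∀ {n} → (Fin n → ℤ) → ℤ
sumFin {zero}  f = + 0
sumFin {suc n} f = f zero +ℤ sumFin (λ i → f (suc i))

prodFin : ∀ {n} → (Fin n → ℤ) → ℤ
prodFin {zero}  f = + 1
prodFin {suc n} f = f zero *ℤ prodFin (λ i → f (suc i))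

altSign : ℕ → ℤ
altSign zero    = + 1
altSign (suc k) = - altSign k

finToℕ : ∀ {n} → Fin n → ℕ
finToℕ zero    = zero
finToℕ (suc i) = suc (finToℕ i)

det : ∀ {n} → (Fin n → Fin n → ℤ) → ℤ
det {zero}  M = + 1
det {suc n} M =
  sumFin (λ j → (altSign (finToℕ j) *ℤ M zero j) *ℤ det (λ r c → M (suc r) (punchIn j c)))

-- Graphs given by a (symmetric, irreflexive) Boolean adjacency relation on Fin order

record Graph : Set where
  field
    order : ℕ
    adj   : Fin order → Fin order → Bool
open Graph public

eqb : ∀ {n} → Fin n → Fin n → Bool
eqb i j = does (i ≟ j)

adjMatrix : (G : Graph) → Fin (order G) → Fin (order G) → ℤ
adjMatrix G i j = if adj G i j then + 1 else + 0

charPolyAt : (G : Graph) → ℤ → ℤ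
charPolyAt G x = det (λ i j → (if eqb i j then x else + 0) -ℤ adjMatrix G i j)

-- Polynomial identity is
-- expressed as equality at every integer point (equivalent for polynomials over ℤ).
AIntegral : Graph → Set
AIntegral G = Σ (Fin (order G) → ℤ) λ ev →
  (x : ℤ) → charPolyAt G x ≡ prodFin (λ i → x -ℤ ev i)

-- Graphs given by an edge list (needed for subdivision)

record EdgeGraph : Set where
  field
    nv    : ℕ
    ne    : ℕ
    ends  : Fin ne → Fin nv × Fin nv
open EdgeGraph public

-- K_{p,p}: vertices 0..p-1 and p..2p-1, one edge for each pair (i , j)
completeBipartite : ℕ → EdgeGraph
completeBipartite p = record
  { nv = p + p
  ; ne = p * p
  ; ends = λ e → let (i , j) = remQuot {p} p e in (i ↑ˡ p , p ↑ʳ j)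
  }

-- complement of K_k: k vertices, no edges
emptyGraph : ℕ → Graph
emptyGraph k = record { order = k ; adj = λ _ _ → false }

isEnd : (G : EdgeGraph) → Fin (nv G) → Fin (ne G) → Bool
isEnd G i e = eqb i (proj₁ (ends G e)) ∨ eqb i (proj₂ (ends G e))

-- Subdivision graph S(G): vertices Fin (nv + ne); the first nv are the original
-- vertices, vertex nv + e is the new vertex inserted into edge e.
subdivAdj : (G : EdgeGraph) → Fin (nv G + ne G) → Fin (nv G + ne G) → Bool
subdivAdj G u v with splitAt (nv G) u | splitAt (nv G) v
... | inj₁ i | inj₂ e = isEnd G i e
... | inj₂ e | inj₁ i = isEnd G i e
... | _      | _      = false

subdivision : EdgeGraph → Graph
subdivision G = record { order = nv G + ne G ; adj = subdivAdj G }

-- Subdivision-vertex corona G1 ⊙ G2: vertices Fin ((nv + ne) + nv * order G2);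
-- the first nv + ne form S(G1); vertex (nv+ne) + (i * order G2 + a) is vertex a
-- of the i-th copy of G2, joined to the i-th original vertex of G1.
coronaAdj : (G1 : EdgeGraph) (G2 : Graph) →
  Fin ((nv G1 + ne G1) + nv G1 * order G2) → Fin ((nv G1 + ne G1) + nv G1 * order G2) → Bool
coronaAdj G1 G2 u v with splitAt (nv G1 + ne G1) u | splitAt (nv G1 + ne G1) v
... | inj₁ x | inj₁ y = subdivAdj G1 x y
... | inj₂ w | inj₂ z with remQuot {nv G1} (order G2) w | remQuot {nv G1} (order G2) z
...   | (i , a) | (j , b) = eqb i j ∧ adj G2 a b
coronaAdj G1 G2 u v | inj₁ x | inj₂ z with splitAt (nv G1) x | remQuot {nv G1} (order G2) z
...   | inj₁ i | (j , _) = eqb i j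
...   | inj₂ _ | _       = false
coronaAdj G1 G2 u v | inj₂ w | inj₁ y with splitAt (nv G1) y | remQuot {nv G1} (order G2) w
...   | inj₁ i | (j , _) = eqb i j
...   | inj₂ _ | _       = false

subdivVertexCorona : EdgeGraph → Graph → Graph
subdivVertexCorona G1 G2 = record
  { order = (nv G1 + ne G1) + nv G1 * order G2
  ; adj = coronaAdj G1 G2 }

module Submission where

-- The adjacency matrix A of the corona has an explicit orthogonal basis of integer eigenvectors.
-- Let R be the vertex–edge incidence matrix of K_{p,p} (p = n₁, q = n₂). Helmert bases on the two
-- sides give orthogonal eigenvectors wᵢ of R Rᵀ with eigenvalues μᵢ ∈ {2p, p, 0}. If kᵢ² = q + μᵢ,
-- then (ε kᵢ wᵢ on the vertices, Rᵀ wᵢ on the subdivision vertices, wᵢ on every vertex of the i-th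
-- copy) is an eigenvector with eigenvalue ε kᵢ for ε = ±1; the remaining eigenvectors, supported on
-- subdivision vertices and copies, have eigenvalue 0. For n₁, n₂ as in the statement, q, q + p and
-- q + 2p are the squares of t(2s² − 1), t(2s² + 2s + 1) and t(2s² + 4s + 1).
-- If the columns of P are nonzero, pairwise orthogonal eigenvectors, then Pᵀ P is an invertible
-- diagonal matrix, so det P ≠ 0 and det (xI − A) = ∏ (x − λ) follows from det (M P) = det M · det P,
-- which is proved through the uniqueness of alternating multilinear forms.

open import Defs
open import Data.Nat using (ℕ; zero; suc; s≤s; z≤n)
import Data.Nat as ℕ
open import Data.Fin using (Fin; zero; suc; toℕ; _<_; punchIn; punchOut; inject₁; _↑ˡ_; _↑ʳ_; splitAt; combine; remQuot; _≟_)
open import Data.Fin.Properties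
  using ( suc-injective; punchInᵢ≢i; punchIn-punchOut; punchIn-injective; <-cmp; ↑ˡ-injective; ↑ʳ-injective
        ; splitAt-↑ˡ; splitAt-↑ʳ; splitAt⁻¹-↑ˡ; splitAt⁻¹-↑ʳ; remQuot-combine; combine-remQuot)
open import Data.Bool using (Bool; if_then_else_; _∨_)
open import Data.Bool.Properties using (∧-zeroʳ)
open import Data.Product using (∃; _,_; proj₁; proj₂; uncurry)
open import Data.Sum using (_⊎_; inj₁; inj₂; [_,_]′)
open import Data.Vec.Functional using (_++_)
open import Data.Vec.Functional.Properties using (lookup-++ˡ; lookup-++ʳ)
open import Function using (_∘_; id)
open import Relation.Binary using (tri<; tri≈; tri>)
open import Relation.Binary.PropositionalEquality
open import Relation.Nullary using (Dec; yes; no; contradiction)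

module IntegerMatrices where

  open import Data.Integer using (ℤ; +_; -_; -[1+_]; _+_; _*_; _-_; ≢-nonZero)
  open import Data.Integer.Properties
    using (+-assoc; +-comm; +-identityˡ; +-identityʳ; +-injective; *-comm; *-zeroʳ; *-identityˡ; *-identityʳ
          ; *-distribˡ-+; *-cancelʳ-≡; i*j≡0⇒i≡0∨j≡0; pos-*; neg-distrib-+; neg-distribˡ-*; neg-distribʳ-*; neg-involutive)
  open import Data.Integer.Tactic.RingSolver using (solve-∀)
  open import Data.List using (List; []; _∷_; allFin)
  open import Data.List.Membership.Propositional using (_∉_)
  open import Data.List.Membership.Propositional.Properties using (∈-allFin)
  open import Data.List.Relation.Unary.Any using (here; there)
  open import Data.Nat.Properties using (m+n≡0⇒m≡0; m+n≡0⇒n≡0)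

  sumFin-cong : ∀ {n} {f g : Fin n → ℤ} → (∀ i → f i ≡ g i) → sumFin f ≡ sumFin g
  sumFin-cong {zero}  f≗g = refl
  sumFin-cong {suc n} f≗g = cong₂ _+_ (f≗g zero) (sumFin-cong (f≗g ∘ suc))

  sumFin-zero : ∀ {n} {f : Fin n → ℤ} → (∀ i → f i ≡ + 0) → sumFin f ≡ + 0
  sumFin-zero {zero}  f≗0 = refl
  sumFin-zero {suc n} f≗0 = cong₂ _+_ (f≗0 zero) (sumFin-zero (f≗0 ∘ suc))

  sumFin-+ : ∀ {n} (f g : Fin n → ℤ) → sumFin (λ i → f i + g i) ≡ sumFin f + sumFin g
  sumFin-+ {zero}  f g = refl
  sumFin-+ {suc n} f g = trans (cong (_+_ (f zero + g zero)) (sumFin-+ (f ∘ suc) (g ∘ suc)))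
                               (interchange (f zero) (g zero) (sumFin (f ∘ suc)) (sumFin (g ∘ suc)))
    where
    interchange : ∀ a b c d → (a + b) + (c + d) ≡ (a + c) + (b + d)
    interchange = solve-∀

  sumFin-*ˡ : ∀ {n} (c : ℤ) (f : Fin n → ℤ) → sumFin (λ i → c * f i) ≡ c * sumFin f
  sumFin-*ˡ {zero}  c f = sym (*-zeroʳ c)
  sumFin-*ˡ {suc n} c f = trans (cong (_+_ (c * f zero)) (sumFin-*ˡ c (f ∘ suc)))
                                (sym (*-distribˡ-+ c (f zero) (sumFin (f ∘ suc))))

  sumFin-*ʳ : ∀ {n} (f : Fin n → ℤ) (c : ℤ) → sumFin (λ i → f i * c) ≡ sumFin f * c
  sumFin-*ʳ f c = trans (sumFin-cong (λ i → *-comm (f i) c)) (trans (sumFin-*ˡ c f) (*-comm c (sumFin f)))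

  sumFin-neg : ∀ {n} (f : Fin n → ℤ) → sumFin (λ i → - f i) ≡ - sumFin f
  sumFin-neg {zero}  f = refl
  sumFin-neg {suc n} f = trans (cong (_+_ (- f zero)) (sumFin-neg (f ∘ suc)))
                               (sym (neg-distrib-+ (f zero) (sumFin (f ∘ suc))))

  sumFin-const : ∀ {n} (c : ℤ) → sumFin (λ (_ : Fin n) → c) ≡ + n * c
  sumFin-const {zero}  c = refl
  sumFin-const {suc n} c = trans (cong (_+_ c) (sumFin-const {n} c)) (succ-* c (+ n))
    where
    succ-* : ∀ c n → c + n * c ≡ (+ 1 + n) * c
    succ-* = solve-∀

  sumFin-swap : ∀ {m n} (f : Fin m → Fin n → ℤ) →
    sumFin (λ i → sumFin (f i)) ≡ sumFin (λ j → sumFin (λ i → f i j))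
  sumFin-swap {zero} {n} f = sym (sumFin-zero {n} (λ _ → refl))
  sumFin-swap {suc m} f = trans (cong (_+_ (sumFin (f zero))) (sumFin-swap (f ∘ suc)))
                                (sym (sumFin-+ (f zero) (λ j → sumFin (λ i → f (suc i) j))))

  sumFin-punchIn : ∀ {n} (f : Fin (suc n) → ℤ) j → sumFin f ≡ f j + sumFin (f ∘ punchIn j)
  sumFin-punchIn         f zero    = refl
  sumFin-punchIn {suc n} f (suc j) = trans (cong (_+_ (f zero)) (sumFin-punchIn (f ∘ suc) j))
                                           (left-commute (f zero) (f (suc j)) _)
    where
    left-commute : ∀ a b c → a + (b + c) ≡ b + (a + c)
    left-commute = solve-∀

  sumFin-↑ : ∀ m {n} (f : Fin (m ℕ.+ n) → ℤ) →
    sumFin f ≡ sumFin (λ i → f (i ↑ˡ n)) + sumFin (λ j → f (m ↑ʳ j))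
  sumFin-↑ zero    f = sym (+-identityˡ (sumFin f))
  sumFin-↑ (suc m) f = trans (cong (_+_ (f zero)) (sumFin-↑ m (f ∘ suc))) (sym (+-assoc (f zero) _ _))

  sumFin-combine : ∀ m {n} (f : Fin (m ℕ.* n) → ℤ) →
    sumFin f ≡ sumFin (λ i → sumFin (λ j → f (combine {m} {n} i j)))
  sumFin-combine zero        f = refl
  sumFin-combine (suc m) {n} f =
    trans (sumFin-↑ n f) (cong (_+_ (sumFin (λ j → f (j ↑ˡ (m ℕ.* n))))) (sumFin-combine m (λ k → f (n ↑ʳ k))))

  δ : ∀ {n} → Fin n → Fin n → ℤ
  δ zero    zero    = + 1
  δ zero    (suc _) = + 0
  δ (suc _) zero    = + 0
  δ (suc i) (suc j) = δ i j

  δ-refl : ∀ {n} (i : Fin n) → δ i i ≡ + 1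
  δ-refl zero    = refl
  δ-refl (suc i) = δ-refl i

  δ-≢ : ∀ {n} {i j : Fin n} → i ≢ j → δ i j ≡ + 0
  δ-≢ {i = zero}  {zero}  i≢j = contradiction refl i≢j
  δ-≢ {i = zero}  {suc j} i≢j = refl
  δ-≢ {i = suc i} {zero}  i≢j = refl
  δ-≢ {i = suc i} {suc j} i≢j = δ-≢ (i≢j ∘ cong suc)

  δ-sym : ∀ {n} (i j : Fin n) → δ i j ≡ δ j i
  δ-sym zero    zero    = refl
  δ-sym zero    (suc j) = refl
  δ-sym (suc i) zero    = refl
  δ-sym (suc i) (suc j) = δ-sym i j

  sumFin-δˡ : ∀ {n} (j : Fin n) (f : Fin n → ℤ) → sumFin (λ i → δ i j * f i) ≡ f j
  sumFin-δˡ {suc n} zero    f = trans (cong₂ _+_ (*-identityˡ (f zero)) (sumFin-zero {n} (λ _ → refl))) (+-identityʳ (f zero))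
  sumFin-δˡ         (suc j) f = trans (+-identityˡ _) (sumFin-δˡ j (f ∘ suc))

  sumFin-δʳ : ∀ {n} (j : Fin n) (f : Fin n → ℤ) → sumFin (λ i → δ j i * f i) ≡ f j
  sumFin-δʳ j f = trans (sumFin-cong (λ i → cong (_* f i) (δ-sym j i))) (sumFin-δˡ j f)

  δ-injective : ∀ {m n} (f : Fin m → Fin n) → (∀ {x y} → f x ≡ f y → x ≡ y) →
    ∀ x y → δ (f x) (f y) ≡ δ x y
  δ-injective f f-inj x y with x ≟ y
  ... | yes refl = trans (δ-refl (f x)) (sym (δ-refl x))
  ... | no x≢y   = trans (δ-≢ (x≢y ∘ f-inj)) (sym (δ-≢ x≢y))

  δ-↑ˡ-↑ʳ : ∀ {m n} (x : Fin m) (y : Fin n) → δ (x ↑ˡ n) (m ↑ʳ y) ≡ + 0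
  δ-↑ˡ-↑ʳ {m} {n} x y =
    δ-≢ λ eq → inj₁≢inj₂ (trans (sym (splitAt-↑ˡ m x n)) (trans (cong (splitAt m) eq) (splitAt-↑ʳ m n y)))
    where
    inj₁≢inj₂ : ∀ {a b} → inj₁ {B = Fin n} a ≢ inj₂ b
    inj₁≢inj₂ ()

  if-eqb : ∀ {n} (i j : Fin n) (x : ℤ) → (if eqb i j then x else + 0) ≡ δ i j * x
  if-eqb i j x with i ≟ j
  ... | yes refl = sym (trans (cong (_* x) (δ-refl i)) (*-identityˡ x))
  ... | no i≢j   = sym (cong (_* x) (δ-≢ i≢j))

  sumFin-antisymmetric : ∀ {n} (f : Fin n → Fin n → ℤ) → (∀ i j → f j i ≡ - f i j) →
    sumFin (λ i → sumFin (f i)) ≡ + 0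
  sumFin-antisymmetric f f-antisym = self-negating (begin
    S                                             ≡⟨ sumFin-swap f ⟩
    sumFin (λ j → sumFin (λ i → f i j))           ≡⟨ sumFin-cong (λ j → sumFin-cong (λ i → f-antisym j i)) ⟩
    sumFin (λ j → sumFin (λ i → - f j i))         ≡⟨ sumFin-cong (λ j → sumFin-neg (f j)) ⟩
    sumFin (λ j → - sumFin (f j))                 ≡⟨ sumFin-neg (λ j → sumFin (f j)) ⟩
    - S                                           ∎)
    where
    open ≡-Reasoning
    S : ℤ
    S = sumFin (λ i → sumFin (f i))
    self-negating : ∀ {x} → x ≡ - x → x ≡ + 0
    self-negating {+ zero}    _  = refl
    self-negating {+ suc _}   ()
    self-negating { -[1+ _ ]} ()

  Matrix : ℕ → Set
  Matrix n = Fin n → Fin n → ℤ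

  infix 4 _≐_
  _≐_ : ∀ {n} → Matrix n → Matrix n → Set
  A ≐ B = ∀ i c → A i c ≡ B i c

  AgreeOff : ∀ {n} → Fin n → Matrix n → Matrix n → Set
  AgreeOff r A B = ∀ i → i ≢ r → ∀ c → A i c ≡ B i c

  sgn : ∀ {n} → Fin n → ℤ
  sgn j = altSign (finToℕ j)

  minor : ∀ {n} → Matrix (suc n) → Fin (suc n) → Matrix n
  minor M j r c = M (suc r) (punchIn j c)

  cofactorTerm : ∀ {n} → Matrix (suc n) → Fin (suc n) → ℤ
  cofactorTerm M j = (sgn j * M zero j) * det (minor M j)

  record IsAlternatingForm {n} (D : Matrix n → ℤ) : Set where
    field
      ext         : ∀ A B → A ≐ B → D A ≡ D B
      linear      : ∀ A B C r a → AgreeOff r A B → AgreeOff r A C →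
                    (∀ c → A r c ≡ B r c + a * C r c) → D A ≡ D B + a * D C
      alternating : ∀ A r s → r ≢ s → (∀ c → A r c ≡ A s c) → D A ≡ + 0

  sumFin-linear : ∀ {n} {t b c : Fin n → ℤ} a → (∀ j → t j ≡ b j + a * c j) →
    sumFin t ≡ sumFin b + a * sumFin c
  sumFin-linear {b = b} {c} a t≗b+ac =
    trans (sumFin-cong t≗b+ac) (trans (sumFin-+ b (λ j → a * c j)) (cong (_+_ (sumFin b)) (sumFin-*ˡ a c)))

  det-ext : ∀ {n} (A B : Matrix n) → A ≐ B → det A ≡ det B
  det-ext {zero}  A B A≐B = refl
  det-ext {suc n} A B A≐B = sumFin-cong λ j →
    cong₂ (λ x d → (sgn j * x) * d) (A≐B zero j) (det-ext (minor A j) (minor B j) (λ r c → A≐B (suc r) (punchIn j c)))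

  det-linear : ∀ {n} (A B C : Matrix n) r a → AgreeOff r A B → AgreeOff r A C →
    (∀ c → A r c ≡ B r c + a * C r c) → det A ≡ det B + a * det C
  det-linear {suc n} A B C zero a A~B A~C rowA = sumFin-linear {b = cofactorTerm B} {cofactorTerm C} a λ j →
    let minorA≐minorB = λ r c → A~B (suc r) (λ ()) (punchIn j c)
        minorB≐minorC = λ r c → trans (sym (minorA≐minorB r c)) (A~C (suc r) (λ ()) (punchIn j c))
    in trans (cong₂ (λ x d → (sgn j * x) * d) (rowA j) (det-ext (minor A j) (minor B j) minorA≐minorB))
             (trans (expand (sgn j) (B zero j) (C zero j) a (det (minor B j)))
                    (cong (λ d → (sgn j * B zero j) * det (minor B j) + a * ((sgn j * C zero j) * d))
                          (det-ext (minor B j) (minor C j) minorB≐minorC)))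
    where
    expand : ∀ s b c a d → (s * (b + a * c)) * d ≡ (s * b) * d + a * ((s * c) * d)
    expand = solve-∀
  det-linear {suc n} A B C (suc r) a A~B A~C rowA = sumFin-linear {b = cofactorTerm B} {cofactorTerm C} a λ j →
    trans (cong ((sgn j * A zero j) *_)
                (det-linear (minor A j) (minor B j) (minor C j) r a
                  (λ i i≢r c → A~B (suc i) (i≢r ∘ suc-injective) (punchIn j c))
                  (λ i i≢r c → A~C (suc i) (i≢r ∘ suc-injective) (punchIn j c))
                  (rowA ∘ punchIn j)))
          (trans (expand (sgn j * A zero j) (det (minor B j)) a (det (minor C j)))
                 (cong₂ (λ x y → (sgn j * x) * det (minor B j) + a * ((sgn j * y) * det (minor C j)))
                        (A~B zero (λ ()) j) (A~C zero (λ ()) j)))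
    where
    expand : ∀ x d a e → x * (d + a * e) ≡ x * d + a * (x * e)
    expand = solve-∀

  withRow : ∀ {n} → Matrix n → Fin n → (Fin n → ℤ) → Matrix n
  withRow A r v i with i ≟ r
  ... | yes _ = v
  ... | no _  = A i

  withRow-≡ : ∀ {n} (A : Matrix n) r v c → withRow A r v r c ≡ v c
  withRow-≡ A r v c with r ≟ r
  ... | yes _  = refl
  ... | no r≢r = contradiction refl r≢r

  withRow-≢ : ∀ {n} (A : Matrix n) {r} v i → i ≢ r → ∀ c → withRow A r v i c ≡ A i c
  withRow-≢ A {r} v i i≢r c with i ≟ r
  ... | yes i≡r = contradiction i≡r i≢r
  ... | no _    = refl

  withRow-agreeOff : ∀ {n} (A B : Matrix n) r u v → AgreeOff r A B → AgreeOff r (withRow A r u) (withRow B r v)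
  withRow-agreeOff A B r u v A~B i i≢r c =
    trans (withRow-≢ A u i i≢r c) (trans (A~B i i≢r c) (sym (withRow-≢ B v i i≢r c)))

  withRow-self : ∀ {n} (A : Matrix n) r → withRow A r (A r) ≐ A
  withRow-self A r i c with i ≟ r
  ... | yes refl = refl
  ... | no _     = refl

  withRow-cong : ∀ {n} (A : Matrix n) r {u v} → (∀ c → u c ≡ v c) → withRow A r u ≐ withRow A r v
  withRow-cong A r u≗v i c with i ≟ r
  ... | yes _ = u≗v c
  ... | no _  = refl

  withRow-elim : ∀ {n} (P : Fin n → (Fin n → ℤ) → Set) (A : Matrix n) r v →
    P r v → (∀ i → i ≢ r → P i (A i)) → ∀ i → P i (withRow A r v i)
  withRow-elim P A r v Pr Pother i with i ≟ r
  ... | yes refl = Pr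
  ... | no i≢r   = Pother i i≢r

  replaceRows : ∀ {n} → Matrix n → Fin n → Fin n → (Fin n → ℤ) → (Fin n → ℤ) → Matrix n
  replaceRows A r s u v = withRow (withRow A s v) r u

  module _ {n} (A : Matrix n) {r s : Fin n} (r≢s : r ≢ s) where

    replaceRows-r : ∀ u v c → replaceRows A r s u v r c ≡ u c
    replaceRows-r u v = withRow-≡ (withRow A s v) r u

    replaceRows-s : ∀ u v c → replaceRows A r s u v s c ≡ v c
    replaceRows-s u v c = trans (withRow-≢ (withRow A s v) u s (r≢s ∘ sym) c) (withRow-≡ A s v c)

    replaceRows-other : ∀ u v i → i ≢ r → i ≢ s → ∀ c → replaceRows A r s u v i c ≡ A i c
    replaceRows-other u v i i≢r i≢s c = trans (withRow-≢ (withRow A s v) u i i≢r c) (withRow-≢ A v i i≢s c)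

    replaceRows-agreeOff-r : ∀ u u' v → AgreeOff r (replaceRows A r s u v) (replaceRows A r s u' v)
    replaceRows-agreeOff-r u u' v = withRow-agreeOff (withRow A s v) (withRow A s v) r u u' (λ _ _ _ → refl)

    replaceRows-agreeOff-s : ∀ u v v' → AgreeOff s (replaceRows A r s u v) (replaceRows A r s u v')
    replaceRows-agreeOff-s u v v' i i≢s c = by-cases (i ≟ r)
      where
      by-cases : Dec (i ≡ r) → replaceRows A r s u v i c ≡ replaceRows A r s u v' i c
      by-cases (yes refl) = trans (replaceRows-r u v c) (sym (replaceRows-r u v' c))
      by-cases (no i≢r)   = trans (replaceRows-other u v i i≢r i≢s c) (sym (replaceRows-other u v' i i≢r i≢s c))

  module _ {n} {D : Matrix n → ℤ} (isAlt : IsAlternatingForm D) where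
    open IsAlternatingForm isAlt

    -- Expanding D at rows r, s = (A r + A s, A r + A s) leaves D A + D B: the repeated-row terms vanish.
    swap-negates : ∀ A B r s → r ≢ s → (∀ c → B r c ≡ A s c) → (∀ c → B s c ≡ A r c) →
      (∀ i → i ≢ r → i ≢ s → ∀ c → B i c ≡ A i c) → D B ≡ - D A
    swap-negates A B r s r≢s Br≗As Bs≗Ar B≗A = solve-for-DB D-sum-zero
      where
      M : (Fin n → ℤ) → (Fin n → ℤ) → Matrix n
      M = replaceRows A r s
      _⊕_ : (Fin n → ℤ) → (Fin n → ℤ) → Fin n → ℤ
      (u ⊕ u') c = u c + u' c

      one-* : ∀ x y → x + y ≡ x + + 1 * y
      one-* = solve-∀

      additive-r : ∀ u u' v → D (M (u ⊕ u') v) ≡ D (M u v) + D (M u' v)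
      additive-r u u' v = trans (linear (M (u ⊕ u') v) (M u v) (M u' v) r (+ 1)
        (replaceRows-agreeOff-r A r≢s (u ⊕ u') u v) (replaceRows-agreeOff-r A r≢s (u ⊕ u') u' v)
        (λ c → trans (replaceRows-r A r≢s (u ⊕ u') v c)
                 (trans (one-* (u c) (u' c))
                   (sym (cong₂ (λ x y → x + + 1 * y) (replaceRows-r A r≢s u v c) (replaceRows-r A r≢s u' v c))))))
        (sym (one-* (D (M u v)) (D (M u' v))))

      additive-s : ∀ u v v' → D (M u (v ⊕ v')) ≡ D (M u v) + D (M u v')
      additive-s u v v' = trans (linear (M u (v ⊕ v')) (M u v) (M u v') s (+ 1)
        (replaceRows-agreeOff-s A r≢s u (v ⊕ v') v) (replaceRows-agreeOff-s A r≢s u (v ⊕ v') v')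
        (λ c → trans (replaceRows-s A r≢s u (v ⊕ v') c)
                 (trans (one-* (v c) (v' c))
                   (sym (cong₂ (λ x y → x + + 1 * y) (replaceRows-s A r≢s u v c) (replaceRows-s A r≢s u v' c))))))
        (sym (one-* (D (M u v)) (D (M u v'))))

      repeated : ∀ u → D (M u u) ≡ + 0
      repeated u = alternating (M u u) r s r≢s (λ c → trans (replaceRows-r A r≢s u u c) (sym (replaceRows-s A r≢s u u c)))

      rows : ∀ {X : Matrix n} u v → (∀ c → X r c ≡ u c) → (∀ c → X s c ≡ v c) →
        (∀ i → i ≢ r → i ≢ s → ∀ c → X i c ≡ A i c) → D (M u v) ≡ D X
      rows {X} u v Xr Xs Xi = ext (M u v) X row-by-row
        where
        row-by-row : M u v ≐ X
        row-by-row i c = by-cases (i ≟ r) (i ≟ s)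
          where
          by-cases : Dec (i ≡ r) → Dec (i ≡ s) → M u v i c ≡ X i c
          by-cases (yes refl) _          = trans (replaceRows-r A r≢s u v c) (sym (Xr c))
          by-cases (no _)     (yes refl) = trans (replaceRows-s A r≢s u v c) (sym (Xs c))
          by-cases (no i≢r)   (no i≢s)   = trans (replaceRows-other A r≢s u v i i≢r i≢s c) (sym (Xi i i≢r i≢s c))

      D-sum-zero : D A + D B ≡ + 0
      D-sum-zero = begin
        D A + D B
          ≡⟨ cong₂ _+_ (rows (A r) (A s) (λ _ → refl) (λ _ → refl) (λ _ _ _ _ → refl))
                       (rows (A s) (A r) Br≗As Bs≗Ar B≗A) ⟨
        D (M (A r) (A s)) + D (M (A s) (A r))
          ≡⟨ drop-repeated (D (M (A r) (A s))) (D (M (A s) (A r))) (repeated (A r)) (repeated (A s)) ⟨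
        (D (M (A r) (A r)) + D (M (A r) (A s))) + (D (M (A s) (A r)) + D (M (A s) (A s)))
          ≡⟨ cong₂ _+_ (additive-s (A r) (A r) (A s)) (additive-s (A s) (A r) (A s)) ⟨
        D (M (A r) (A r ⊕ A s)) + D (M (A s) (A r ⊕ A s))
          ≡⟨ additive-r (A r) (A s) (A r ⊕ A s) ⟨
        D (M (A r ⊕ A s) (A r ⊕ A s))
          ≡⟨ repeated (A r ⊕ A s) ⟩
        + 0 ∎
        where
        open ≡-Reasoning
        drop-repeated : ∀ {a d} b c → a ≡ + 0 → d ≡ + 0 → (a + b) + (c + d) ≡ b + c
        drop-repeated b c refl refl = drop-zeros b c
          where
          drop-zeros : ∀ b c → (+ 0 + b) + (c + + 0) ≡ b + c
          drop-zeros = solve-∀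

      solve-for-DB : D A + D B ≡ + 0 → D B ≡ - D A
      solve-for-DB sum≡0 = trans (rearrange (D A) (D B)) (trans (cong (_+_ (- D A)) sum≡0) (+-identityʳ (- D A)))
        where
        rearrange : ∀ a b → b ≡ - a + (a + b)
        rearrange = solve-∀

  -- A total punchOut: the position of j once i is removed (junk when i ≡ j).
  punchOut′ : ∀ {k} → Fin (suc (suc k)) → Fin (suc (suc k)) → Fin (suc k)
  punchOut′ zero          zero          = zero
  punchOut′ zero          (suc j)       = j
  punchOut′ (suc i)       zero          = zero
  punchOut′ {zero}  (suc i) (suc j)     = zero
  punchOut′ {suc k} (suc i) (suc j)     = suc (punchOut′ i j)

  punchOut′-punchIn : ∀ {k} (i : Fin (suc (suc k))) (j : Fin (suc k)) → punchOut′ i (punchIn i j) ≡ j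
  punchOut′-punchIn zero    j       = refl
  punchOut′-punchIn (suc i) zero    = refl
  punchOut′-punchIn {suc k} (suc i) (suc j) = cong suc (punchOut′-punchIn i j)

  punchIn-punchOut′-swap : ∀ {k} (i j : Fin (suc (suc k))) → i ≢ j → ∀ (c : Fin k) →
    punchIn i (punchIn (punchOut′ i j) c) ≡ punchIn j (punchIn (punchOut′ j i) c)
  punchIn-punchOut′-swap zero    zero    i≢j c = contradiction refl i≢j
  punchIn-punchOut′-swap zero    (suc j) i≢j c = refl
  punchIn-punchOut′-swap (suc i) zero    i≢j c = refl
  punchIn-punchOut′-swap {suc k} (suc i) (suc j) i≢j zero    = refl
  punchIn-punchOut′-swap {suc k} (suc i) (suc j) i≢j (suc c) = cong suc (punchIn-punchOut′-swap i j (i≢j ∘ cong suc) c)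

  sgn-punchOut′-swap : ∀ {k} (i j : Fin (suc (suc k))) → i ≢ j →
    sgn i * sgn (punchOut′ i j) ≡ - (sgn j * sgn (punchOut′ j i))
  sgn-punchOut′-swap zero    zero    i≢j = contradiction refl i≢j
  sgn-punchOut′-swap zero    (suc j) i≢j = one-left (sgn j)
    where
    one-left : ∀ x → + 1 * x ≡ - ((- x) * + 1)
    one-left = solve-∀
  sgn-punchOut′-swap (suc i) zero    i≢j = one-right (sgn i)
    where
    one-right : ∀ x → (- x) * + 1 ≡ - (+ 1 * x)
    one-right = solve-∀
  sgn-punchOut′-swap {zero}  (suc zero) (suc zero) i≢j = contradiction refl i≢j
  sgn-punchOut′-swap {suc k} (suc i)    (suc j)    i≢j =
    trans (neg-*-neg (sgn i) (sgn (punchOut′ i j)))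
          (trans (sgn-punchOut′-swap i j (i≢j ∘ cong suc)) (cong -_ (sym (neg-*-neg (sgn j) (sgn (punchOut′ j i))))))
    where
    neg-*-neg : ∀ a b → (- a) * (- b) ≡ a * b
    neg-*-neg = solve-∀

  pairSign : ∀ {k} → Fin (suc (suc k)) → Fin (suc (suc k)) → ℤ
  pairSign i j with i ≟ j
  ... | yes _ = + 0
  ... | no _  = sgn i * sgn (punchOut′ i j)

  pairSign-refl : ∀ {k} (i : Fin (suc (suc k))) → pairSign i i ≡ + 0
  pairSign-refl i with i ≟ i
  ... | yes _  = refl
  ... | no i≢i = contradiction refl i≢i

  pairSign-≢ : ∀ {k} {i j : Fin (suc (suc k))} → i ≢ j → pairSign i j ≡ sgn i * sgn (punchOut′ i j)
  pairSign-≢ {i = i} {j} i≢j with i ≟ j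
  ... | yes i≡j = contradiction i≡j i≢j
  ... | no _    = refl

  pairSign-antisym : ∀ {k} (i j : Fin (suc (suc k))) → pairSign j i ≡ - pairSign i j
  pairSign-antisym i j = by-cases (i ≟ j)
    where
    by-cases : Dec (i ≡ j) → pairSign j i ≡ - pairSign i j
    by-cases (yes refl) = trans (pairSign-refl i) (cong -_ (sym (pairSign-refl i)))
    by-cases (no i≢j)   = trans (pairSign-≢ (i≢j ∘ sym))
                                (trans (sym (neg-involutive _))
                                       (cong -_ (trans (sym (sgn-punchOut′-swap i j i≢j)) (sym (pairSign-≢ i≢j)))))

  -- Expanding along rows 0 and 1 writes det A as a double sum of terms antisymmetric in the two columns.
  det-equal-first-rows : ∀ {m} (A : Matrix (suc (suc m))) → (∀ c → A zero c ≡ A (suc zero) c) → det A ≡ + 0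
  det-equal-first-rows {m} A row₀≗row₁ =
    trans (sumFin-cong cofactorTerm≡rowSum) (sumFin-antisymmetric term term-antisym)
    where
    open ≡-Reasoning
    doubleMinor : Fin (suc (suc m)) → Fin (suc (suc m)) → ℤ
    doubleMinor i j = det (λ r c → A (suc (suc r)) (punchIn i (punchIn (punchOut′ i j) c)))

    term : Fin (suc (suc m)) → Fin (suc (suc m)) → ℤ
    term i j = pairSign i j * (A zero i * A zero j) * doubleMinor i j

    term-diag : ∀ i → term i i ≡ + 0
    term-diag i = cong (λ s → s * (A zero i * A zero i) * doubleMinor i i) (pairSign-refl i)

    term-antisym : ∀ i j → term j i ≡ - term i j
    term-antisym i j = by-cases (i ≟ j)
     where
     by-cases : Dec (i ≡ j) → term j i ≡ - term i j
     by-cases (yes refl) = trans (term-diag i) (cong -_ (sym (term-diag i)))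
     by-cases (no i≢j)   = begin
      pairSign j i * (A zero j * A zero i) * doubleMinor j i
        ≡⟨ cong₂ (λ s d → s * (A zero j * A zero i) * d) (pairSign-antisym i j)
                 (det-ext _ _ λ r c → cong (A (suc (suc r))) (sym (punchIn-punchOut′-swap i j i≢j c))) ⟩
      (- pairSign i j) * (A zero j * A zero i) * doubleMinor i j
        ≡⟨ swap-and-negate (pairSign i j) (A zero i) (A zero j) (doubleMinor i j) ⟩
      - term i j ∎
      where
      swap-and-negate : ∀ s a b d → (- s) * (b * a) * d ≡ - (s * (a * b) * d)
      swap-and-negate = solve-∀

    cofactorTerm≡rowSum : ∀ i → cofactorTerm A i ≡ sumFin (term i)
    cofactorTerm≡rowSum i = begin
      (sgn i * A zero i) * det (minor A i)
        ≡⟨ sumFin-*ˡ (sgn i * A zero i) (cofactorTerm (minor A i)) ⟨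
      sumFin (λ k → (sgn i * A zero i) * cofactorTerm (minor A i) k)
        ≡⟨ sumFin-cong (λ k → term-punchIn k) ⟩
      sumFin (λ k → term i (punchIn i k))
        ≡⟨ +-identityˡ _ ⟨
      + 0 + sumFin (λ k → term i (punchIn i k))
        ≡⟨ cong (_+ sumFin (λ k → term i (punchIn i k))) (term-diag i) ⟨
      term i i + sumFin (λ k → term i (punchIn i k))
        ≡⟨ sumFin-punchIn (term i) i ⟨
      sumFin (term i) ∎
      where
      term-punchIn : ∀ k → (sgn i * A zero i) * cofactorTerm (minor A i) k ≡ term i (punchIn i k)
      term-punchIn k = begin
        (sgn i * A zero i) * ((sgn k * A (suc zero) (punchIn i k)) * det (minor (minor A i) k))
          ≡⟨ regroup (sgn i) (sgn k) (A zero i) _ _ ⟩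
        (sgn i * sgn k) * (A zero i * A (suc zero) (punchIn i k)) * det (minor (minor A i) k)
          ≡⟨ cong₂ (λ s a → s * (A zero i * a) * det (minor (minor A i) k))
                   (sym (trans (pairSign-≢ (punchInᵢ≢i i k ∘ sym)) (cong (λ j → sgn i * sgn j) (punchOut′-punchIn i k))))
                   (sym (row₀≗row₁ (punchIn i k))) ⟩
        pairSign i (punchIn i k) * (A zero i * A zero (punchIn i k)) * det (minor (minor A i) k)
          ≡⟨ cong (pairSign i (punchIn i k) * (A zero i * A zero (punchIn i k)) *_)
                  (det-ext (minor (minor A i) k) (λ r c → A (suc (suc r)) (punchIn i (punchIn (punchOut′ i (punchIn i k)) c)))
                           λ r c → cong (λ j → A (suc (suc r)) (punchIn i (punchIn j c))) (sym (punchOut′-punchIn i k))) ⟩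
        term i (punchIn i k) ∎
        where
        regroup : ∀ si sk a b d → (si * a) * ((sk * b) * d) ≡ (si * sk) * (a * b) * d
        regroup = solve-∀

  det-isAlternatingForm : ∀ {n} → (∀ (A : Matrix n) r s → r ≢ s → (∀ c → A r c ≡ A s c) → det A ≡ + 0) →
    IsAlternatingForm (det {n})
  det-isAlternatingForm alternating = record { ext = det-ext ; linear = det-linear ; alternating = alternating }

  -- Swapping rows 1 and s + 2 reduces to the case of equal first two rows.
  det-first-row-repeated : ∀ {n} → IsAlternatingForm (det {n}) →
    ∀ (A : Matrix (suc n)) s → (∀ c → A zero c ≡ A (suc s) c) → det A ≡ + 0
  det-first-row-repeated _ A zero rows≡ = det-equal-first-rows A rows≡
  det-first-row-repeated {suc n} det-isAlt A (suc s) rows≡ =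
    trans (sym (neg-involutive (det A))) (cong -_ (trans (sym detB≡-detA) detB≡0))
    where
    r₁ r₂ : Fin (suc (suc n))
    r₁ = suc zero
    r₂ = suc (suc s)
    r₁≢r₂ : r₁ ≢ r₂
    r₁≢r₂ ()
    B : Matrix (suc (suc n))
    B = replaceRows A r₁ r₂ (A r₂) (A r₁)
    row₀ : ∀ c → B zero c ≡ A zero c
    row₀ = replaceRows-other A r₁≢r₂ (A r₂) (A r₁) zero (λ ()) (λ ())

    detB≡0 : det B ≡ + 0
    detB≡0 = det-equal-first-rows B λ c → trans (row₀ c) (trans (rows≡ c) (sym (replaceRows-r A r₁≢r₂ (A r₂) (A r₁) c)))

    detB≡-detA : det B ≡ - det A
    detB≡-detA = trans (sumFin-cong swapped-minors) (sumFin-neg (cofactorTerm A))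
      where
      swapped-minors : ∀ j → cofactorTerm B j ≡ - cofactorTerm A j
      swapped-minors j = trans
        (cong₂ (λ x d → (sgn j * x) * d) (row₀ j)
          (swap-negates det-isAlt (minor A j) (minor B j) zero (suc s) (λ ())
            (λ c → replaceRows-r A r₁≢r₂ (A r₂) (A r₁) (punchIn j c))
            (λ c → replaceRows-s A r₁≢r₂ (A r₂) (A r₁) (punchIn j c))
            (λ i i≢0 i≢s c → replaceRows-other A r₁≢r₂ (A r₂) (A r₁) (suc i)
                                 (i≢0 ∘ suc-injective) (i≢s ∘ suc-injective) (punchIn j c))))
        (sym (neg-distribʳ-* (sgn j * A zero j) (det (minor A j))))

  det-alternating : ∀ {n} (A : Matrix n) r s → r ≢ s → (∀ c → A r c ≡ A s c) → det A ≡ + 0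
  det-alternating         A zero    zero    r≢s _     = contradiction refl r≢s
  det-alternating {suc n} A zero    (suc s) _   rows≡ =
    det-first-row-repeated (det-isAlternatingForm (det-alternating {n})) A s rows≡
  det-alternating {suc n} A (suc r) zero    _   rows≡ =
    det-first-row-repeated (det-isAlternatingForm (det-alternating {n})) A r (sym ∘ rows≡)
  det-alternating {suc n} A (suc r) (suc s) r≢s rows≡ = sumFin-zero λ j →
    trans (cong ((sgn j * A zero j) *_) (det-alternating {n} (minor A j) r s (r≢s ∘ cong suc) (rows≡ ∘ punchIn j)))
          (*-zeroʳ (sgn j * A zero j))

  I : ∀ {n} → Matrix n
  I = δ

  module _ {n} {D : Matrix n → ℤ} (isAlt : IsAlternatingForm D) where
    open IsAlternatingForm isAlt

    zero-row : ∀ A r → (∀ c → A r c ≡ + 0) → D A ≡ + 0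
    zero-row A r Ar≗0 = self-doubling (linear A A A r (+ 1) (λ _ _ _ → refl) (λ _ _ _ → refl)
                                         (λ c → trans (Ar≗0 c) (sym (cong₂ (λ x y → x + + 1 * y) (Ar≗0 c) (Ar≗0 c)))))
      where
      self-doubling : ∀ {x} → x ≡ x + + 1 * x → x ≡ + 0
      self-doubling {x} eq = trans (cancel x) (trans (cong (_- x) (sym eq)) (x-x x))
        where
        cancel : ∀ x → x ≡ (x + + 1 * x) - x
        cancel = solve-∀
        x-x : ∀ x → x - x ≡ + 0
        x-x = solve-∀

    row-sum : ∀ {k} (cs : Fin k → ℤ) (vs : Fin k → Fin n → ℤ) A r →
      (∀ c → A r c ≡ sumFin (λ t → cs t * vs t c)) → D A ≡ sumFin (λ t → cs t * D (withRow A r (vs t)))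
    row-sum {zero}  cs vs A r Ar≗sum = zero-row A r Ar≗sum
    row-sum {suc k} cs vs A r Ar≗sum = begin
      D A
        ≡⟨ linear A B C r (cs zero) A~B A~C rowA ⟩
      D B + cs zero * D C
        ≡⟨ cong (_+ cs zero * D C) (row-sum (cs ∘ suc) (vs ∘ suc) B r (withRow-≡ A r rest)) ⟩
      sumFin (λ t → cs (suc t) * D (withRow B r (vs (suc t)))) + cs zero * D C
        ≡⟨ cong (_+ cs zero * D C) (sumFin-cong λ t → cong (cs (suc t) *_) (ext _ _ (withRow-twice (vs (suc t))))) ⟩
      sumFin (λ t → cs (suc t) * D (withRow A r (vs (suc t)))) + cs zero * D C
        ≡⟨ +-comm _ (cs zero * D C) ⟩
      sumFin (λ t → cs t * D (withRow A r (vs t))) ∎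
      where
      open ≡-Reasoning
      rest : Fin n → ℤ
      rest c = sumFin (λ t → cs (suc t) * vs (suc t) c)
      B C : Matrix n
      B = withRow A r rest
      C = withRow A r (vs zero)
      A~B : AgreeOff r A B
      A~B i i≢r c = sym (withRow-≢ A rest i i≢r c)
      A~C : AgreeOff r A C
      A~C i i≢r c = sym (withRow-≢ A (vs zero) i i≢r c)
      rowA : ∀ c → A r c ≡ B r c + cs zero * C r c
      rowA c = trans (Ar≗sum c) (trans (+-comm _ (rest c))
        (sym (cong₂ (λ x y → x + cs zero * y) (withRow-≡ A r rest c) (withRow-≡ A r (vs zero) c))))
      withRow-twice : ∀ v → withRow B r v ≐ withRow A r v
      withRow-twice v i c with i ≟ r
      ... | yes _   = refl
      ... | no i≢r  = withRow-≢ A rest i i≢r c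

    add-row-multiple : ∀ A r s a → r ≢ s → D (withRow A r (λ c → A r c + a * A s c)) ≡ D A
    add-row-multiple A r s a r≢s = begin
      D (withRow A r (λ c → A r c + a * A s c))
        ≡⟨ linear _ _ _ r a (withRow-agreeOff A A r _ _ (λ _ _ _ → refl)) (withRow-agreeOff A A r _ _ (λ _ _ _ → refl))
                  (λ c → trans (withRow-≡ A r _ c)
                               (sym (cong₂ (λ x y → x + a * y) (withRow-≡ A r (A r) c) (withRow-≡ A r (A s) c)))) ⟩
      D (withRow A r (A r)) + a * D (withRow A r (A s))
        ≡⟨ cong₂ (λ x y → x + a * y) (ext _ _ (withRow-self A r))
                 (alternating _ r s r≢s (λ c → trans (withRow-≡ A r (A s) c) (sym (withRow-≢ A (A s) s (r≢s ∘ sym) c)))) ⟩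
      D A + a * + 0
        ≡⟨ trans (cong (_+_ (D A)) (*-zeroʳ a)) (+-identityʳ (D A)) ⟩
      D A ∎
      where open ≡-Reasoning

  module _ {m} {D : Matrix (suc m) → ℤ} (isAlt : IsAlternatingForm D) (j : Fin (suc m)) where
    open IsAlternatingForm isAlt

    -- Each row of X is the corresponding row of Y plus a multiple of the first row, so the rows can be
    -- replaced one at a time.
    clear-column : ∀ X Y → (∀ c → X zero c ≡ δ j c) → (∀ c → Y zero c ≡ δ j c) →
      (∀ i c → c ≢ j → X i c ≡ Y i c) → D X ≡ D Y
    clear-column X Y X₀≗δ Y₀≗δ X≈Y =
      clear-rows (allFin (suc m)) X X₀≗δ X≈Y (λ i i∉ → contradiction (∈-allFin i) i∉)
      where
      fix-row : ∀ r Z → (∀ c → Z zero c ≡ δ j c) → (∀ i c → c ≢ j → Z i c ≡ Y i c) → D Z ≡ D (withRow Z r (Y r))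
      fix-row zero    Z Z₀≗δ Z≈Y = ext _ _ λ i c →
        sym (trans (withRow-cong Z zero (λ c → trans (Y₀≗δ c) (sym (Z₀≗δ c))) i c) (withRow-self Z zero i c))
      fix-row (suc r) Z Z₀≗δ Z≈Y =
        trans (sym (add-row-multiple isAlt Z (suc r) zero a (λ ()))) (ext _ _ (withRow-cong Z (suc r) row))
        where
        a : ℤ
        a = Y (suc r) j - Z (suc r) j
        row : ∀ c → Z (suc r) c + a * Z zero c ≡ Y (suc r) c
        row c with c ≟ j
        ... | yes refl = trans (cong (λ e → Z (suc r) c + a * e) (trans (Z₀≗δ c) (δ-refl c)))
                               (corrects (Z (suc r) c) (Y (suc r) c))
          where
          corrects : ∀ z y → z + (y - z) * + 1 ≡ y
          corrects = solve-∀
        ... | no c≢j   = trans (cong (λ e → Z (suc r) c + a * e) (trans (Z₀≗δ c) (δ-≢ (c≢j ∘ sym))))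
                               (trans (cong (_+_ (Z (suc r) c)) (*-zeroʳ a)) (trans (+-identityʳ _) (Z≈Y (suc r) c c≢j)))

      clear-rows : ∀ rs Z → (∀ c → Z zero c ≡ δ j c) → (∀ i c → c ≢ j → Z i c ≡ Y i c) →
        (∀ i → i ∉ rs → ∀ c → Z i c ≡ Y i c) → D Z ≡ D Y
      clear-rows []       Z _    _   done = ext Z Y (λ i → done i λ ())
      clear-rows (r ∷ rs) Z Z₀≗δ Z≈Y done = trans (fix-row r Z Z₀≗δ Z≈Y) (clear-rows rs Z′ Z′₀≗δ Z′≈Y done′)
        where
        Z′ : Matrix (suc m)
        Z′ = withRow Z r (Y r)
        Z′₀≗δ : ∀ c → Z′ zero c ≡ δ j c
        Z′₀≗δ = withRow-elim (λ i w → i ≡ zero → ∀ c → w c ≡ δ j c) Z r (Y r)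
                  (λ { refl → Y₀≗δ }) (λ { i _ refl → Z₀≗δ }) zero refl
        Z′≈Y : ∀ i c → c ≢ j → Z′ i c ≡ Y i c
        Z′≈Y = withRow-elim (λ i w → ∀ c → c ≢ j → w c ≡ Y i c) Z r (Y r) (λ _ _ → refl) (λ i _ → Z≈Y i)
        done′ : ∀ i → i ∉ rs → ∀ c → Z′ i c ≡ Y i c
        done′ i = withRow-elim (λ i w → i ∉ rs → ∀ c → w c ≡ Y i c) Z r (Y r) (λ _ _ → refl)
                    (λ i i≢r i∉rs → done i λ { (here i≡r) → i≢r i≡r ; (there i∈rs) → i∉rs i∈rs }) i

  insertZeroAt : ∀ {m} → Fin (suc m) → (Fin m → ℤ) → Fin (suc m) → ℤ
  insertZeroAt j v c with j ≟ c
  ... | yes _   = + 0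
  ... | no j≢c  = v (punchOut j≢c)

  insertZeroAt-cong : ∀ {m} j {u v : Fin m → ℤ} → (∀ c → u c ≡ v c) → ∀ c → insertZeroAt j u c ≡ insertZeroAt j v c
  insertZeroAt-cong j u≗v c with j ≟ c
  ... | yes _   = refl
  ... | no j≢c  = u≗v (punchOut j≢c)

  insertZeroAt-linear : ∀ {m} j {v u w : Fin m → ℤ} a → (∀ c → v c ≡ u c + a * w c) →
    ∀ c → insertZeroAt j v c ≡ insertZeroAt j u c + a * insertZeroAt j w c
  insertZeroAt-linear j a v≗u+aw c with j ≟ c
  ... | yes _   = sym (trans (+-identityˡ (a * + 0)) (*-zeroʳ a))
  ... | no j≢c  = v≗u+aw (punchOut j≢c)

  insertZeroAt-punchIn : ∀ {m} j (v : Fin (suc m) → ℤ) c → c ≢ j → insertZeroAt j (v ∘ punchIn j) c ≡ v c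
  insertZeroAt-punchIn j v c c≢j with j ≟ c
  ... | yes j≡c = contradiction (sym j≡c) c≢j
  ... | no j≢c  = cong v (punchIn-punchOut j≢c)

  insertZeroAt-δ : ∀ {m} j (r : Fin m) c → insertZeroAt j (δ r) c ≡ δ (punchIn j r) c
  insertZeroAt-δ j r c with j ≟ c
  ... | yes refl = sym (δ-≢ (punchInᵢ≢i j r))
  ... | no j≢c   = trans (sym (δ-injective (punchIn j) (punchIn-injective j _ _) r (punchOut j≢c)))
                         (cong (δ (punchIn j r)) (punchIn-punchOut j≢c))

  border : ∀ {m} → Fin (suc m) → Matrix m → Matrix (suc m)
  border j N zero    = δ j
  border j N (suc r) = insertZeroAt j (N r)

  border-isAlternatingForm : ∀ {m} {D : Matrix (suc m) → ℤ} → IsAlternatingForm D → ∀ j → IsAlternatingForm (D ∘ border j)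
  border-isAlternatingForm {D = D} isAlt j = record
    { ext         = λ N N′ N≐N′ → ext _ _ λ { zero c → refl ; (suc i) c → insertZeroAt-cong j (N≐N′ i) c }
    ; linear      = λ N N₁ N₂ r a N~N₁ N~N₂ rowN →
        linear _ _ _ (suc r) a (agreeOff N N₁ r N~N₁) (agreeOff N N₂ r N~N₂) (insertZeroAt-linear j a rowN)
    ; alternating = λ N r s r≢s rows≡ → alternating _ (suc r) (suc s) (r≢s ∘ suc-injective) (insertZeroAt-cong j rows≡)
    }
    where
    open IsAlternatingForm isAlt
    agreeOff : ∀ N N′ r → AgreeOff r N N′ → AgreeOff (suc r) (border j N) (border j N′)
    agreeOff N N′ r N~N′ zero    _     c = refl
    agreeOff N N′ r N~N′ (suc i) i≢sr c = insertZeroAt-cong j (N~N′ i (i≢sr ∘ cong suc)) c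

  punchIn-inject₁-self : ∀ {m} (j : Fin m) → punchIn (inject₁ j) j ≡ suc j
  punchIn-inject₁-self zero    = refl
  punchIn-inject₁-self (suc j) = cong suc (punchIn-inject₁-self j)

  punchIn-suc-self : ∀ {m} (j : Fin m) → punchIn (suc j) j ≡ inject₁ j
  punchIn-suc-self zero    = refl
  punchIn-suc-self (suc j) = cong suc (punchIn-suc-self j)

  punchIn-suc≡punchIn-inject₁ : ∀ {m} (j r : Fin m) → r ≢ j → punchIn (suc j) r ≡ punchIn (inject₁ j) r
  punchIn-suc≡punchIn-inject₁ zero    zero    r≢j = contradiction refl r≢j
  punchIn-suc≡punchIn-inject₁ zero    (suc r) r≢j = refl
  punchIn-suc≡punchIn-inject₁ (suc j) zero    r≢j = refl
  punchIn-suc≡punchIn-inject₁ (suc j) (suc r) r≢j = cong suc (punchIn-suc≡punchIn-inject₁ j r (r≢j ∘ cong suc))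

  finToℕ-inject₁ : ∀ {m} (j : Fin m) → finToℕ (inject₁ j) ≡ finToℕ j
  finToℕ-inject₁ zero    = refl
  finToℕ-inject₁ (suc j) = cong suc (finToℕ-inject₁ j)

  -- border (suc j) I is border (inject₁ j) I with rows 0 and suc j swapped.
  border-I : ∀ {m} {D : Matrix (suc m) → ℤ} → IsAlternatingForm D → ∀ j → D (border j I) ≡ sgn j * D I
  border-I {D = D} isAlt j = by-position (finToℕ j) j refl
    where
    open IsAlternatingForm isAlt
    by-position : ∀ k j → finToℕ j ≡ k → D (border j I) ≡ sgn j * D I
    by-position _ zero _ = trans (ext _ _ border₀≐I) (sym (*-identityˡ (D I)))
      where
      border₀≐I : border zero I ≐ I
      border₀≐I zero    c = refl
      border₀≐I (suc i) c = insertZeroAt-δ zero i c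
    by-position zero    (suc j) ()
    by-position (suc k) (suc j) j≡k = begin
      D (border (suc j) I)
        ≡⟨ swap-negates isAlt (border (inject₁ j) I) (border (suc j) I) zero (suc j) (λ ())
             (λ c → sym (trans (insertZeroAt-δ (inject₁ j) j c) (cong (λ r → δ r c) (punchIn-inject₁-self j))))
             (λ c → trans (insertZeroAt-δ (suc j) j c) (cong (λ r → δ r c) (punchIn-suc-self j)))
             other-rows ⟩
      - D (border (inject₁ j) I)
        ≡⟨ cong -_ (by-position k (inject₁ j) (trans (finToℕ-inject₁ j) (cong ℕ.pred j≡k))) ⟩
      - (sgn (inject₁ j) * D I)
        ≡⟨ neg-distribˡ-* (sgn (inject₁ j)) (D I) ⟩
      (- sgn (inject₁ j)) * D I
        ≡⟨ cong (λ k → (- altSign k) * D I) (finToℕ-inject₁ j) ⟩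
      sgn (suc j) * D I ∎
      where
      open ≡-Reasoning
      other-rows : ∀ i → i ≢ zero → i ≢ suc j → ∀ c → border (suc j) I i c ≡ border (inject₁ j) I i c
      other-rows zero    i≢0 _     c = contradiction refl i≢0
      other-rows (suc i) _   i≢j c = trans (insertZeroAt-δ (suc j) i c)
        (trans (cong (λ r → δ r c) (punchIn-suc≡punchIn-inject₁ j i (i≢j ∘ cong suc)))
               (sym (insertZeroAt-δ (inject₁ j) i c)))

  -- Expand row 0 in unit vectors δ j, clear column j, and apply induction to the alternating form
  -- N ↦ D (border j N) of size n - 1.
  alternatingForm-unique : ∀ {n} {D : Matrix n → ℤ} → IsAlternatingForm D → ∀ A → D A ≡ det A * D I
  alternatingForm-unique {zero}      isAlt A = trans (IsAlternatingForm.ext isAlt A I (λ ())) (sym (*-identityˡ _))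
  alternatingForm-unique {suc m} {D} isAlt A = begin
    D A                                                  ≡⟨ row-sum isAlt (A zero) δ A zero row₀-in-unit-vectors ⟩
    sumFin (λ j → A zero j * D (withRow A zero (δ j)))   ≡⟨ sumFin-cong unit-row ⟩
    sumFin (λ j → cofactorTerm A j * D I)                ≡⟨ sumFin-*ʳ (cofactorTerm A) (D I) ⟩
    det A * D I                                          ∎
    where
    open ≡-Reasoning
    row₀-in-unit-vectors : ∀ c → A zero c ≡ sumFin (λ t → A zero t * δ t c)
    row₀-in-unit-vectors c = sym (trans (sumFin-cong λ t → *-comm (A zero t) (δ t c)) (sumFin-δˡ c (A zero)))

    cleared : ∀ j i c → c ≢ j → withRow A zero (δ j) i c ≡ border j (minor A j) i c
    cleared j zero    c _   = withRow-≡ A zero (δ j) c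
    cleared j (suc i) c c≢j = trans (withRow-≢ A {zero} (δ j) (suc i) (λ ()) c) (sym (insertZeroAt-punchIn j (A (suc i)) c c≢j))

    unit-row : ∀ j → A zero j * D (withRow A zero (δ j)) ≡ cofactorTerm A j * D I
    unit-row j = begin
      A zero j * D (withRow A zero (δ j))
        ≡⟨ cong (A zero j *_) (clear-column isAlt j _ _ (withRow-≡ A zero (δ j)) (λ _ → refl) (cleared j)) ⟩
      A zero j * D (border j (minor A j))
        ≡⟨ cong (A zero j *_) (alternatingForm-unique (border-isAlternatingForm isAlt j) (minor A j)) ⟩
      A zero j * (det (minor A j) * D (border j I))
        ≡⟨ cong (λ x → A zero j * (det (minor A j) * x)) (border-I isAlt j) ⟩
      A zero j * (det (minor A j) * (sgn j * D I))
        ≡⟨ regroup (A zero j) (det (minor A j)) (sgn j) (D I) ⟩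
      cofactorTerm A j * D I ∎
      where
      regroup : ∀ a d s x → a * (d * (s * x)) ≡ ((s * a) * d) * x
      regroup = solve-∀

  infixl 7 _*ᴹ_
  _*ᴹ_ : ∀ {n} → Matrix n → Matrix n → Matrix n
  (A *ᴹ B) i k = sumFin (λ j → A i j * B j k)

  det-*ᴹ : ∀ {n} (A B : Matrix n) → det (A *ᴹ B) ≡ det A * det B
  det-*ᴹ {n} A B =
    trans (alternatingForm-unique isAlt A) (cong (det A *_) (det-ext (I *ᴹ B) B λ i k → sumFin-δʳ i (λ j → B j k)))
    where
    *ᴹB-cong : ∀ (X Y : Matrix n) i → (∀ c → X i c ≡ Y i c) → ∀ k → (X *ᴹ B) i k ≡ (Y *ᴹ B) i k
    *ᴹB-cong X Y i Xi≗Yi k = sumFin-cong λ j → cong (_* B j k) (Xi≗Yi j)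
    isAlt : IsAlternatingForm (λ X → det (X *ᴹ B))
    isAlt = record
      { ext         = λ X Y X≐Y → det-ext _ _ λ i → *ᴹB-cong X Y i (X≐Y i)
      ; linear      = λ X Y Z r a X~Y X~Z rowX → det-linear _ _ _ r a
          (λ i i≢r → *ᴹB-cong X Y i (X~Y i i≢r)) (λ i i≢r → *ᴹB-cong X Z i (X~Z i i≢r))
          (λ k → sumFin-linear {b = λ j → Y r j * B j k} {λ j → Z r j * B j k} a λ j →
                   trans (cong (_* B j k) (rowX j)) (distrib (Y r j) a (Z r j) (B j k)))
      ; alternating = λ X r s r≢s rows≡ → det-alternating _ r s r≢s λ k → sumFin-cong λ j → cong (_* B j k) (rows≡ j)
      }
      where
      distrib : ∀ y a z b → (y + a * z) * b ≡ y * b + a * (z * b)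
      distrib = solve-∀

  diagonal : ∀ {n} → (Fin n → ℤ) → Matrix n
  diagonal d i j = δ i j * d j

  det-diagonal : ∀ {n} (d : Fin n → ℤ) → det (diagonal d) ≡ prodFin d
  det-diagonal {zero}  d = refl
  det-diagonal {suc n} d = begin
    cofactorTerm (diagonal d) zero + sumFin (cofactorTerm (diagonal d) ∘ suc)
      ≡⟨ cong₂ _+_ (cong ((+ 1 * (+ 1 * d zero)) *_) (det-diagonal (d ∘ suc))) (sumFin-zero off-diagonal) ⟩
    (+ 1 * (+ 1 * d zero)) * prodFin (d ∘ suc) + + 0
      ≡⟨ simplify (d zero) (prodFin (d ∘ suc)) ⟩
    prodFin d ∎
    where
    open ≡-Reasoning
    off-diagonal : ∀ j → cofactorTerm (diagonal d) (suc j) ≡ + 0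
    off-diagonal j = zero-entry (sgn (suc j)) (d (suc j)) (det (minor (diagonal d) (suc j)))
      where
      zero-entry : ∀ s x y → (s * (+ 0 * x)) * y ≡ + 0
      zero-entry = solve-∀
    simplify : ∀ a b → (+ 1 * (+ 1 * a)) * b + + 0 ≡ a * b
    simplify = solve-∀

  prodFin-nonzero : ∀ {n} (d : Fin n → ℤ) → (∀ c → d c ≢ + 0) → prodFin d ≢ + 0
  prodFin-nonzero {zero}  d d≢0 ()
  prodFin-nonzero {suc n} d d≢0 prod≡0 with i*j≡0⇒i≡0∨j≡0 (d zero) prod≡0
  ... | inj₁ d₀≡0   = d≢0 zero d₀≡0
  ... | inj₂ rest≡0 = prodFin-nonzero (d ∘ suc) (d≢0 ∘ suc) rest≡0

  transpose : ∀ {n} → Matrix n → Matrix n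
  transpose A i j = A j i

  square-nonneg : ∀ x → ∃ λ m → x * x ≡ + m
  square-nonneg (+ m)      = _ , sym (pos-* m m)
  square-nonneg -[1+ m ]   = _ , refl

  sumFin-squares-nonneg : ∀ {n} (f : Fin n → ℤ) → ∃ λ m → sumFin (λ k → f k * f k) ≡ + m
  sumFin-squares-nonneg {zero}  f = 0 , refl
  sumFin-squares-nonneg {suc n} f with square-nonneg (f zero) | sumFin-squares-nonneg (f ∘ suc)
  ... | a , f₀²≡a | b , rest≡b = a ℕ.+ b , cong₂ _+_ f₀²≡a rest≡b

  sumFin-squares≡0 : ∀ {n} (f : Fin n → ℤ) → sumFin (λ k → f k * f k) ≡ + 0 → ∀ k → f k ≡ + 0
  sumFin-squares≡0 {suc n} f sum≡0 k with square-nonneg (f zero) | sumFin-squares-nonneg (f ∘ suc)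
  ... | a , f₀²≡a | b , rest≡b = at k
    where
    a+b≡0 : a ℕ.+ b ≡ 0
    a+b≡0 = +-injective (trans (sym (cong₂ _+_ f₀²≡a rest≡b)) sum≡0)
    at : ∀ k → f k ≡ + 0
    at zero    = [ id , id ]′ (i*j≡0⇒i≡0∨j≡0 (f zero) (trans f₀²≡a (cong +_ (m+n≡0⇒m≡0 a a+b≡0))))
    at (suc k) = sumFin-squares≡0 (f ∘ suc) (trans rest≡b (cong +_ (m+n≡0⇒n≡0 a a+b≡0))) k

  det-orthogonalEigenbasis : ∀ {n} (M P : Matrix n) (λ′ : Fin n → ℤ) →
    (∀ i c → (M *ᴹ P) i c ≡ P i c * λ′ c) → (∀ c e → c ≢ e → (transpose P *ᴹ P) c e ≡ + 0) →
    (∀ c → ∃ λ k → P k c ≢ + 0) → det M ≡ prodFin λ′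
  det-orthogonalEigenbasis {n} M P λ′ MP≐Pλ orthogonal nonzero =
    *-cancelʳ-≡ (det M) (prodFin λ′) (det P) {{≢-nonZero detP≢0}} (begin
      det M * det P               ≡⟨ det-*ᴹ M P ⟨
      det (M *ᴹ P)                ≡⟨ det-ext _ _ MP≐PΛ ⟩
      det (P *ᴹ diagonal λ′)      ≡⟨ det-*ᴹ P (diagonal λ′) ⟩
      det P * det (diagonal λ′)   ≡⟨ cong (det P *_) (det-diagonal λ′) ⟩
      det P * prodFin λ′          ≡⟨ *-comm (det P) (prodFin λ′) ⟩
      prodFin λ′ * det P          ∎)
    where
    open ≡-Reasoning
    MP≐PΛ : M *ᴹ P ≐ P *ᴹ diagonal λ′
    MP≐PΛ i c = trans (MP≐Pλ i c)
      (sym (trans (sumFin-cong λ j → regroup (P i j) (δ j c) (λ′ c)) (sumFin-δˡ c (λ j → P i j * λ′ c))))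
      where
      regroup : ∀ p d l → p * (d * l) ≡ d * (p * l)
      regroup = solve-∀

    Δ : Fin n → ℤ
    Δ c = (transpose P *ᴹ P) c c

    PᵀP≐Δ : transpose P *ᴹ P ≐ diagonal Δ
    PᵀP≐Δ c e with c ≟ e
    ... | yes refl = sym (trans (cong (_* Δ c) (δ-refl c)) (*-identityˡ (Δ c)))
    ... | no c≢e   = trans (orthogonal c e c≢e) (sym (cong (_* Δ e) (δ-≢ c≢e)))

    Δ≢0 : ∀ c → Δ c ≢ + 0
    Δ≢0 c Δc≡0 with nonzero c
    ... | k , Pkc≢0 = Pkc≢0 (sumFin-squares≡0 (λ k → P k c) Δc≡0 k)

    detP≢0 : det P ≢ + 0
    detP≢0 detP≡0 = prodFin-nonzero Δ Δ≢0 (begin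
      prodFin Δ                   ≡⟨ det-diagonal Δ ⟨
      det (diagonal Δ)            ≡⟨ det-ext _ _ PᵀP≐Δ ⟨
      det (transpose P *ᴹ P)      ≡⟨ det-*ᴹ (transpose P) P ⟩
      det (transpose P) * det P   ≡⟨ cong (det (transpose P) *_) detP≡0 ⟩
      det (transpose P) * + 0     ≡⟨ *-zeroʳ (det (transpose P)) ⟩
      + 0                         ∎)

  δ-both-zero : ∀ {n} {a a′ : Fin (suc n)} → a ≢ a′ → δ a zero * δ a′ zero ≡ + 0
  δ-both-zero {a = zero}  {zero}   a≢a′ = contradiction refl a≢a′
  δ-both-zero {a = zero}  {suc a′} _    = refl
  δ-both-zero {a = suc a} {a′}     _    = refl

  indicator : Bool → ℤ
  indicator b = if b then + 1 else + 0

  indicator-eqb : ∀ {n} (i j : Fin n) → indicator (eqb i j) ≡ δ i j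
  indicator-eqb i j = trans (if-eqb i j (+ 1)) (*-identityʳ (δ i j))

open IntegerMatrices

module HelmertBasis where

  open import Data.Integer using (ℤ; +_; -_; _+_; _*_; _-_)
  open import Data.Integer.Properties
    using (*-identityˡ; *-identityʳ; *-zeroʳ; *-comm)
  open import Data.Integer.Tactic.RingSolver using (solve-∀)

  -- staircase c h = (1, …, 1, -c, 0, …, 0) with h + 1 leading ones.
  staircase : ∀ {r} → ℤ → Fin r → Fin (suc r) → ℤ
  staircase c zero    zero          = + 1
  staircase c zero    (suc zero)    = - c
  staircase c zero    (suc (suc _)) = + 0
  staircase c (suc h) zero          = + 1
  staircase c (suc h) (suc x)       = staircase c h x

  sumFin-staircase : ∀ {r} c (h : Fin r) → sumFin (staircase c h) ≡ (+ toℕ h + + 1) - c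
  sumFin-staircase {suc r} c zero    = trans (cong (λ s → + 1 + (- c + s)) (sumFin-zero {r} (λ _ → refl))) (ones-minus c)
    where
    ones-minus : ∀ c → + 1 + (- c + + 0) ≡ (+ 0 + + 1) - c
    ones-minus = solve-∀
  sumFin-staircase {suc r} c (suc h) = trans (cong (_+_ (+ 1)) (sumFin-staircase c h)) (one-more (+ toℕ h) c)
    where
    one-more : ∀ t c → + 1 + ((t + + 1) - c) ≡ ((+ 1 + t) + + 1) - c
    one-more = solve-∀

  staircase-zero : ∀ {r} c (h : Fin r) → staircase c h zero ≡ + 1
  staircase-zero c zero    = refl
  staircase-zero c (suc h) = refl

  staircase-nested : ∀ {r} c c′ {h h′ : Fin r} → h < h′ → ∀ x → staircase c h x ≡ + 0 ⊎ staircase c′ h′ x ≡ + 1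
  staircase-nested c c′ {zero}  {suc h′} _          zero          = inj₂ refl
  staircase-nested c c′ {zero}  {suc h′} _          (suc zero)    = inj₂ (staircase-zero c′ h′)
  staircase-nested c c′ {zero}  {suc h′} _          (suc (suc x)) = inj₁ refl
  staircase-nested c c′ {suc h} {suc h′} _          zero          = inj₂ refl
  staircase-nested c c′ {suc h} {suc h′} (s≤s h<h′) (suc x)       = staircase-nested c c′ h<h′ x

  sumFin-*-selective : ∀ {n} (f g : Fin n → ℤ) → (∀ x → f x ≡ + 0 ⊎ g x ≡ + 1) →
    sumFin (λ x → f x * g x) ≡ sumFin f
  sumFin-*-selective f g f≡0⊎g≡1 = sumFin-cong λ x → select (f≡0⊎g≡1 x)
    where
    select : ∀ {x} → f x ≡ + 0 ⊎ g x ≡ + 1 → f x * g x ≡ f x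
    select {x} (inj₁ fx≡0) = trans (cong (_* g x) fx≡0) (sym fx≡0)
    select {x} (inj₂ gx≡1) = trans (cong (f x *_) gx≡1) (*-identityʳ (f x))

  -- The (unnormalised) Helmert basis: an orthogonal basis of ℤ^(r+1) starting with (1, …, 1).
  helmert : ∀ {r} → Fin (suc r) → Fin (suc r) → ℤ
  helmert zero    x = + 1
  helmert (suc h) x = staircase (+ suc (toℕ h)) h x

  helmert-zero : ∀ {r} (a : Fin (suc r)) → helmert a zero ≡ + 1
  helmert-zero zero    = refl
  helmert-zero (suc h) = staircase-zero _ h

  sumFin-helmert-suc : ∀ {r} (h : Fin r) → sumFin (helmert (suc h)) ≡ + 0
  sumFin-helmert-suc h = trans (sumFin-staircase _ h) (cancel (+ toℕ h))
    where
    cancel : ∀ t → (t + + 1) - (+ 1 + t) ≡ + 0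
    cancel = solve-∀


  sumFin-helmert : ∀ {r} (a : Fin (suc r)) → sumFin (helmert a) ≡ + suc r * δ a zero
  sumFin-helmert {r} zero = sumFin-const {suc r} (+ 1)
  sumFin-helmert {r} (suc h) = trans (sumFin-helmert-suc h) (sym (*-zeroʳ (+ suc r)))

  -- Where an earlier staircase is nonzero a later one is 1, so their product sums like the earlier one.
  helmert-orthogonal : ∀ {r} (a a′ : Fin (suc r)) → a ≢ a′ → sumFin (λ x → helmert a x * helmert a′ x) ≡ + 0
  helmert-orthogonal zero    zero     a≢a′ = contradiction refl a≢a′
  helmert-orthogonal zero    (suc h′) _    = trans (sumFin-cong (λ x → *-identityˡ (helmert (suc h′) x))) (sumFin-helmert-suc h′)
  helmert-orthogonal (suc h) zero     _    = trans (sumFin-cong (λ x → *-identityʳ (helmert (suc h) x))) (sumFin-helmert-suc h)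
  helmert-orthogonal (suc h) (suc h′) a≢a′ with <-cmp h h′
  ... | tri< h<h′ _ _ = trans (sumFin-*-selective _ _ (staircase-nested _ _ h<h′)) (sumFin-helmert-suc h)
  ... | tri≈ _ h≡h′ _ = contradiction (cong suc h≡h′) a≢a′
  ... | tri> _ _ h′<h = trans (sumFin-cong (λ x → *-comm (helmert (suc h) x) (helmert (suc h′) x)))
                              (trans (sumFin-*-selective _ _ (staircase-nested _ _ h′<h)) (sumFin-helmert-suc h′))

open HelmertBasis

↑-elim : ∀ {m n} (P : Fin (m ℕ.+ n) → Set) → (∀ i → P (i ↑ˡ n)) → (∀ j → P (m ↑ʳ j)) → ∀ k → P k
↑-elim {m} P left right k with splitAt m k in eq
... | inj₁ i = subst P (splitAt⁻¹-↑ˡ eq) (left i)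
... | inj₂ j = subst P (splitAt⁻¹-↑ʳ eq) (right j)

combine-elim : ∀ {m n} (P : Fin (m ℕ.* n) → Set) → (∀ i j → P (combine {m} {n} i j)) → ∀ k → P k
combine-elim {m} {n} P pair k = subst P (combine-remQuot {m} n k) (pair (proj₁ (remQuot {m} n k)) (proj₂ (remQuot {m} n k)))

uncurryFin : ∀ {m n} {A : Set} → (Fin m → Fin n → A) → Fin (m ℕ.* n) → A
uncurryFin {n = n} f k = uncurry f (remQuot n k)

uncurryFin-combine : ∀ {m n} {A : Set} (f : Fin m → Fin n → A) i j → uncurryFin f (combine i j) ≡ f i j
uncurryFin-combine f i j = cong (uncurry f) (remQuot-combine i j)

module KppCorona (p′ q′ : ℕ) where

  open import Data.Integer using (ℤ; +_; -_; _+_; _*_; _-_)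
  open import Data.Integer.Properties
    using (+-assoc; +-identityˡ; +-identityʳ; *-assoc; *-identityˡ; *-identityʳ; *-zeroʳ; *-comm
          ; *-distribˡ-+; *-distribʳ-+; pos-*)
  open import Data.Integer.Tactic.RingSolver using (solve-∀)

  p q : ℕ
  p = suc p′
  q = suc q′

  VV EE CC NN : ℕ
  VV = p ℕ.+ p
  EE = p ℕ.* p
  CC = VV ℕ.* q
  NN = (VV ℕ.+ EE) ℕ.+ CC

  lft rgt : Fin p → Fin VV
  lft a = a ↑ˡ p
  rgt b = p ↑ʳ b

  vertex : Fin VV → Fin NN
  vertex v = (v ↑ˡ EE) ↑ˡ CC

  edge : Fin p → Fin p → Fin NN
  edge a b = (VV ↑ʳ combine a b) ↑ˡ CC

  copy : Fin VV → Fin q → Fin NN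
  copy v a′ = (VV ℕ.+ EE) ↑ʳ combine v a′

  sides : ∀ {A : Set} → (Fin p → A) → (Fin p → A) → Fin VV → A
  sides = _++_

  sides-lft : ∀ {A : Set} (f g : Fin p → A) a → sides f g (lft a) ≡ f a
  sides-lft = lookup-++ˡ

  sides-rgt : ∀ {A : Set} (f g : Fin p → A) b → sides f g (rgt b) ≡ g b
  sides-rgt = lookup-++ʳ

  side-elim : (P : Fin VV → Set) → (∀ a → P (lft a)) → (∀ b → P (rgt b)) → ∀ v → P v
  side-elim = ↑-elim

  index-elim : (P : Fin NN → Set) →
    (∀ v → P (vertex v)) → (∀ a b → P (edge a b)) → (∀ v a′ → P (copy v a′)) → ∀ u → P u
  index-elim P onV onE onC = ↑-elim P (↑-elim _ onV (combine-elim {p} {p} _ onE)) (combine-elim {VV} {q} _ onC)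

  sumFin-NN : ∀ (f : Fin NN → ℤ) → sumFin f ≡
    (sumFin (λ v → f (vertex v)) + sumFin (λ a → sumFin (λ b → f (edge a b))))
    + sumFin (λ v → sumFin (λ a′ → f (copy v a′)))
  sumFin-NN f = trans (sumFin-↑ (VV ℕ.+ EE) f)
    (cong₂ _+_ (trans (sumFin-↑ VV (λ x → f (x ↑ˡ CC)))
                      (cong (_+_ (sumFin (λ v → f (vertex v)))) (sumFin-combine p (λ e → f ((VV ↑ʳ e) ↑ˡ CC)))))
               (sumFin-combine VV (λ w → f ((VV ℕ.+ EE) ↑ʳ w))))

  sumFin-VV : ∀ (f : Fin VV → ℤ) → sumFin f ≡ sumFin (λ a → f (lft a)) + sumFin (λ b → f (rgt b))
  sumFin-VV = sumFin-↑ p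

  blocks : ∀ {A : Set} → (Fin VV → A) → (Fin p → Fin p → A) → (Fin VV → Fin q → A) → Fin NN → A
  blocks fV fE fC = (fV ++ uncurryFin fE) ++ uncurryFin fC

  module _ {A : Set} (fV : Fin VV → A) (fE : Fin p → Fin p → A) (fC : Fin VV → Fin q → A) where

    blocks-vertex : ∀ v → blocks fV fE fC (vertex v) ≡ fV v
    blocks-vertex v = trans (lookup-++ˡ (fV ++ uncurryFin fE) (uncurryFin fC) (v ↑ˡ EE)) (lookup-++ˡ fV (uncurryFin fE) v)

    blocks-edge : ∀ a b → blocks fV fE fC (edge a b) ≡ fE a b
    blocks-edge a b = trans (lookup-++ˡ (fV ++ uncurryFin fE) (uncurryFin fC) (VV ↑ʳ combine a b))
                            (trans (lookup-++ʳ fV (uncurryFin fE) (combine a b)) (uncurryFin-combine fE a b))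

    blocks-copy : ∀ v a′ → blocks fV fE fC (copy v a′) ≡ fC v a′
    blocks-copy v a′ = trans (lookup-++ʳ (fV ++ uncurryFin fE) (uncurryFin fC) (combine v a′)) (uncurryFin-combine fC v a′)

  record BlockVec : Set where
    constructor ⟨_,_,_⟩
    field
      onVertex : Fin VV → ℤ
      onEdge   : Fin p → Fin p → ℤ
      onCopy   : Fin VV → Fin q → ℤ
  open BlockVec public

  toVec : BlockVec → Fin NN → ℤ
  toVec x = blocks (onVertex x) (onEdge x) (onCopy x)

  toVec-vertex : ∀ x v → toVec x (vertex v) ≡ onVertex x v
  toVec-vertex x = blocks-vertex (onVertex x) (onEdge x) (onCopy x)

  toVec-edge : ∀ x a b → toVec x (edge a b) ≡ onEdge x a b
  toVec-edge x = blocks-edge (onVertex x) (onEdge x) (onCopy x)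

  toVec-copy : ∀ x v a′ → toVec x (copy v a′) ≡ onCopy x v a′
  toVec-copy x = blocks-copy (onVertex x) (onEdge x) (onCopy x)

  infix 7 _·_
  _·_ : BlockVec → BlockVec → ℤ
  x · y = (sumFin (λ v → onVertex x v * onVertex y v) + sumFin (λ a → sumFin (λ b → onEdge x a b * onEdge y a b)))
        + sumFin (λ v → sumFin (λ a′ → onCopy x v a′ * onCopy y v a′))

  sumFin-toVec-* : ∀ x y → sumFin (λ k → toVec x k * toVec y k) ≡ x · y
  sumFin-toVec-* x y = trans (sumFin-NN (λ k → toVec x k * toVec y k))
    (cong₂ _+_ (cong₂ _+_ (sumFin-cong λ v → cong₂ _*_ (toVec-vertex x v) (toVec-vertex y v))
                          (sumFin-cong λ a → sumFin-cong λ b → cong₂ _*_ (toVec-edge x a b) (toVec-edge y a b)))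
               (sumFin-cong λ v → sumFin-cong λ a′ → cong₂ _*_ (toVec-copy x v a′) (toVec-copy y v a′)))

  G : Graph
  G = subdivVertexCorona (completeBipartite p) (emptyGraph q)

  Adj : Fin NN → Fin NN → ℤ
  Adj = adjMatrix G

  indicator-isEnd : ∀ v a b → indicator (isEnd (completeBipartite p) v (combine a b)) ≡ δ v (lft a) + δ v (rgt b)
  indicator-isEnd v a b =
    trans (cong (λ ab → indicator (eqb v (proj₁ ab ↑ˡ p) ∨ eqb v (p ↑ʳ proj₂ ab))) (remQuot-combine a b))
          (indicator-∨ v a b)
    where
    indicator-∨ : ∀ v a b → indicator (eqb v (lft a) ∨ eqb v (rgt b)) ≡ δ v (lft a) + δ v (rgt b)
    indicator-∨ v a b with v ≟ lft a
    ... | yes refl = sym (cong₂ _+_ (δ-refl (lft a)) (δ-↑ˡ-↑ʳ a b))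
    ... | no v≢a   = trans (indicator-eqb v (rgt b)) (sym (trans (cong (_+ δ v (rgt b)) (δ-≢ v≢a)) (+-identityˡ (δ v (rgt b)))))

  Adj-vertex-vertex : ∀ v v′ → Adj (vertex v) (vertex v′) ≡ + 0
  Adj-vertex-vertex v v′
    rewrite splitAt-↑ˡ (VV ℕ.+ EE) (v ↑ˡ EE) CC | splitAt-↑ˡ (VV ℕ.+ EE) (v′ ↑ˡ EE) CC
          | splitAt-↑ˡ VV v EE | splitAt-↑ˡ VV v′ EE = refl

  Adj-vertex-edge : ∀ v a b → Adj (vertex v) (edge a b) ≡ δ v (lft a) + δ v (rgt b)
  Adj-vertex-edge v a b
    rewrite splitAt-↑ˡ (VV ℕ.+ EE) (v ↑ˡ EE) CC | splitAt-↑ˡ (VV ℕ.+ EE) (VV ↑ʳ combine a b) CC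
          | splitAt-↑ˡ VV v EE | splitAt-↑ʳ VV EE (combine a b) = indicator-isEnd v a b

  Adj-edge-vertex : ∀ a b v → Adj (edge a b) (vertex v) ≡ δ v (lft a) + δ v (rgt b)
  Adj-edge-vertex a b v
    rewrite splitAt-↑ˡ (VV ℕ.+ EE) (v ↑ˡ EE) CC | splitAt-↑ˡ (VV ℕ.+ EE) (VV ↑ʳ combine a b) CC
          | splitAt-↑ˡ VV v EE | splitAt-↑ʳ VV EE (combine a b) = indicator-isEnd v a b

  Adj-vertex-copy : ∀ v w a′ → Adj (vertex v) (copy w a′) ≡ δ v w
  Adj-vertex-copy v w a′
    rewrite splitAt-↑ˡ (VV ℕ.+ EE) (v ↑ˡ EE) CC | splitAt-↑ʳ (VV ℕ.+ EE) CC (combine w a′)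
          | splitAt-↑ˡ VV v EE = trans (cong (indicator ∘ eqb v ∘ proj₁) (remQuot-combine {VV} {q} w a′)) (indicator-eqb v w)

  Adj-copy-vertex : ∀ w a′ v → Adj (copy w a′) (vertex v) ≡ δ v w
  Adj-copy-vertex w a′ v
    rewrite splitAt-↑ˡ (VV ℕ.+ EE) (v ↑ˡ EE) CC | splitAt-↑ʳ (VV ℕ.+ EE) CC (combine w a′)
          | splitAt-↑ˡ VV v EE = trans (cong (indicator ∘ eqb v ∘ proj₁) (remQuot-combine {VV} {q} w a′)) (indicator-eqb v w)

  Adj-edge-edge : ∀ a b a′ b′ → Adj (edge a b) (edge a′ b′) ≡ + 0
  Adj-edge-edge a b a′ b′
    rewrite splitAt-↑ˡ (VV ℕ.+ EE) (VV ↑ʳ combine a b) CC | splitAt-↑ˡ (VV ℕ.+ EE) (VV ↑ʳ combine a′ b′) CC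
          | splitAt-↑ʳ VV EE (combine a b) | splitAt-↑ʳ VV EE (combine a′ b′) = refl

  Adj-edge-copy : ∀ a b w a′ → Adj (edge a b) (copy w a′) ≡ + 0
  Adj-edge-copy a b w a′
    rewrite splitAt-↑ˡ (VV ℕ.+ EE) (VV ↑ʳ combine a b) CC | splitAt-↑ʳ (VV ℕ.+ EE) CC (combine w a′)
          | splitAt-↑ʳ VV EE (combine a b) = refl

  Adj-copy-edge : ∀ w a′ a b → Adj (copy w a′) (edge a b) ≡ + 0
  Adj-copy-edge w a′ a b
    rewrite splitAt-↑ˡ (VV ℕ.+ EE) (VV ↑ʳ combine a b) CC | splitAt-↑ʳ (VV ℕ.+ EE) CC (combine w a′)
          | splitAt-↑ʳ VV EE (combine a b) = refl

  Adj-copy-copy : ∀ w a′ w′ a″ → Adj (copy w a′) (copy w′ a″) ≡ + 0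
  Adj-copy-copy w a′ w′ a″
    rewrite splitAt-↑ʳ (VV ℕ.+ EE) CC (combine w a′) | splitAt-↑ʳ (VV ℕ.+ EE) CC (combine w′ a″) =
      cong indicator (∧-zeroʳ _)

  incidence : (Fin p → Fin p → ℤ) → Fin VV → ℤ
  incidence e v = sumFin (λ a → sumFin (λ b → (δ v (lft a) + δ v (rgt b)) * e a b))

  act : BlockVec → BlockVec
  act x = ⟨ (λ v → incidence (onEdge x) v + sumFin (onCopy x v))
          , (λ a b → onVertex x (lft a) + onVertex x (rgt b))
          , (λ v _ → onVertex x v) ⟩

  Adj-row-blocks : ∀ u x → sumFin (λ k → Adj u k * toVec x k) ≡
    (sumFin (λ v → Adj u (vertex v) * onVertex x v) + sumFin (λ a → sumFin (λ b → Adj u (edge a b) * onEdge x a b)))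
    + sumFin (λ v → sumFin (λ a′ → Adj u (copy v a′) * onCopy x v a′))
  Adj-row-blocks u x = trans (sumFin-NN (λ k → Adj u k * toVec x k))
    (cong₂ _+_ (cong₂ _+_ (sumFin-cong λ v → cong (Adj u (vertex v) *_) (toVec-vertex x v))
                          (sumFin-cong λ a → sumFin-cong λ b → cong (Adj u (edge a b) *_) (toVec-edge x a b)))
               (sumFin-cong λ v → sumFin-cong λ a′ → cong (Adj u (copy v a′) *_) (toVec-copy x v a′)))

  private
    vanishing-edges : ∀ u x → (∀ a b → Adj u (edge a b) ≡ + 0) →
      sumFin (λ a → sumFin (λ b → Adj u (edge a b) * onEdge x a b)) ≡ + 0
    vanishing-edges u x Adj≡0 = sumFin-zero λ a → sumFin-zero λ b → cong (_* onEdge x a b) (Adj≡0 a b)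

    vanishing-copies : ∀ u x → (∀ v a′ → Adj u (copy v a′) ≡ + 0) →
      sumFin (λ v → sumFin (λ a′ → Adj u (copy v a′) * onCopy x v a′)) ≡ + 0
    vanishing-copies u x Adj≡0 = sumFin-zero λ v → sumFin-zero λ a′ → cong (_* onCopy x v a′) (Adj≡0 v a′)

  Adj-action : ∀ x u → sumFin (λ k → Adj u k * toVec x k) ≡ toVec (act x) u
  Adj-action x = index-elim _ at-vertex at-edge at-copy
    where
    at-vertex : ∀ v → sumFin (λ k → Adj (vertex v) k * toVec x k) ≡ toVec (act x) (vertex v)
    at-vertex v = trans (Adj-row-blocks (vertex v) x) (trans (cong₂ _+_
      (cong₂ _+_ (sumFin-zero λ v′ → cong (_* onVertex x v′) (Adj-vertex-vertex v v′))
                 (sumFin-cong λ a → sumFin-cong λ b → cong (_* onEdge x a b) (Adj-vertex-edge v a b)))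
      (trans (sumFin-cong λ w → trans (sumFin-cong λ a′ → cong (_* onCopy x w a′) (Adj-vertex-copy v w a′))
                                      (sumFin-*ˡ (δ v w) (onCopy x w)))
             (sumFin-δʳ v (λ w → sumFin (onCopy x w)))))
      (trans (cong (_+ sumFin (onCopy x v)) (+-identityˡ (incidence (onEdge x) v))) (sym (toVec-vertex (act x) v))))

    at-edge : ∀ a b → sumFin (λ k → Adj (edge a b) k * toVec x k) ≡ toVec (act x) (edge a b)
    at-edge a b = trans (Adj-row-blocks (edge a b) x) (trans (cong₂ _+_
      (cong₂ _+_ (trans (sumFin-cong λ v → trans (cong (_* onVertex x v) (Adj-edge-vertex a b v))
                                                 (*-distribʳ-+ (onVertex x v) (δ v (lft a)) (δ v (rgt b))))
                        (trans (sumFin-+ (λ v → δ v (lft a) * onVertex x v) (λ v → δ v (rgt b) * onVertex x v))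
                               (cong₂ _+_ (sumFin-δˡ (lft a) (onVertex x)) (sumFin-δˡ (rgt b) (onVertex x)))))
                 (vanishing-edges (edge a b) x (Adj-edge-edge a b)))
      (vanishing-copies (edge a b) x (Adj-edge-copy a b)))
      (trans (+-identityʳ _) (trans (+-identityʳ _) (sym (toVec-edge (act x) a b)))))

    at-copy : ∀ w a′ → sumFin (λ k → Adj (copy w a′) k * toVec x k) ≡ toVec (act x) (copy w a′)
    at-copy w a′ = trans (Adj-row-blocks (copy w a′) x) (trans (cong₂ _+_
      (cong₂ _+_ (trans (sumFin-cong λ v → cong (_* onVertex x v) (Adj-copy-vertex w a′ v)) (sumFin-δˡ w (onVertex x)))
                 (vanishing-edges (copy w a′) x (Adj-copy-edge w a′)))
      (vanishing-copies (copy w a′) x (Adj-copy-copy w a′)))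
      (trans (+-identityʳ _) (trans (+-identityʳ _) (sym (toVec-copy (act x) w a′)))))

  incidence-lft : ∀ e x → incidence e (lft x) ≡ sumFin (e x)
  incidence-lft e x = trans (sumFin-cong λ a → trans (sumFin-cong λ b → cong (_* e a b) (lft-endpoint a b))
                                                      (sumFin-*ˡ (δ x a) (e a)))
                            (sumFin-δʳ x (λ a → sumFin (e a)))
    where
    lft-endpoint : ∀ a b → δ (lft x) (lft a) + δ (lft x) (rgt b) ≡ δ x a
    lft-endpoint a b = trans (cong₂ _+_ (δ-injective lft (↑ˡ-injective p _ _) x a) (δ-↑ˡ-↑ʳ x b)) (+-identityʳ (δ x a))

  incidence-rgt : ∀ e y → incidence e (rgt y) ≡ sumFin (λ a → e a y)
  incidence-rgt e y = sumFin-cong λ a → trans (sumFin-cong λ b → cong (_* e a b) (rgt-endpoint a b)) (sumFin-δʳ y (e a))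
    where
    rgt-endpoint : ∀ a b → δ (rgt y) (lft a) + δ (rgt y) (rgt b) ≡ δ y b
    rgt-endpoint a b =
      trans (cong₂ _+_ (trans (δ-sym (rgt y) (lft a)) (δ-↑ˡ-↑ʳ a y)) (δ-injective rgt (↑ʳ-injective p _ _) y b))
                             (+-identityˡ (δ y b))

  incidence-adjoint : ∀ (u : Fin VV → ℤ) (e : Fin p → Fin p → ℤ) →
    sumFin (λ a → sumFin (λ b → (u (lft a) + u (rgt b)) * e a b)) ≡ sumFin (λ v → u v * incidence e v)
  incidence-adjoint u e = begin
    sumFin (λ a → sumFin (λ b → (u (lft a) + u (rgt b)) * e a b))
      ≡⟨ sumFin-cong (λ a → trans (sumFin-cong λ b → *-distribʳ-+ (e a b) (u (lft a)) (u (rgt b)))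
                                  (sumFin-+ (λ b → u (lft a) * e a b) (λ b → u (rgt b) * e a b))) ⟩
    sumFin (λ a → sumFin (λ b → u (lft a) * e a b) + sumFin (λ b → u (rgt b) * e a b))
      ≡⟨ sumFin-+ (λ a → sumFin (λ b → u (lft a) * e a b)) (λ a → sumFin (λ b → u (rgt b) * e a b)) ⟩
    sumFin (λ a → sumFin (λ b → u (lft a) * e a b)) + sumFin (λ a → sumFin (λ b → u (rgt b) * e a b))
      ≡⟨ cong₂ _+_ (sumFin-cong λ a → sumFin-*ˡ (u (lft a)) (e a)) (sumFin-swap (λ a b → u (rgt b) * e a b)) ⟩
    sumFin (λ a → u (lft a) * sumFin (e a)) + sumFin (λ b → sumFin (λ a → u (rgt b) * e a b))
      ≡⟨ cong₂ _+_ (sumFin-cong λ a → cong (u (lft a) *_) (incidence-lft e a))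
                   (sumFin-cong λ b → trans (cong (u (rgt b) *_) (incidence-rgt e b))
                                            (sym (sumFin-*ˡ (u (rgt b)) (λ a → e a b)))) ⟨
    sumFin (λ a → u (lft a) * incidence e (lft a)) + sumFin (λ b → u (rgt b) * incidence e (rgt b))
      ≡⟨ sumFin-VV (λ v → u v * incidence e v) ⟨
    sumFin (λ v → u v * incidence e v) ∎
    where open ≡-Reasoning

  record IsEigenvector (x : BlockVec) (λ′ : ℤ) : Set where
    field
      onVertex-eq : ∀ v → onVertex (act x) v ≡ λ′ * onVertex x v
      onEdge-eq   : ∀ a b → onEdge (act x) a b ≡ λ′ * onEdge x a b
      onCopy-eq   : ∀ v a′ → onCopy (act x) v a′ ≡ λ′ * onCopy x v a′

  toVec-eigenvector : ∀ {x λ′} → IsEigenvector x λ′ → ∀ u → toVec (act x) u ≡ λ′ * toVec x u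
  toVec-eigenvector {x} {λ′} eigen = index-elim _
    (λ v → trans (toVec-vertex (act x) v) (trans (onVertex-eq v) (cong (λ′ *_) (sym (toVec-vertex x v)))))
    (λ a b → trans (toVec-edge (act x) a b) (trans (onEdge-eq a b) (cong (λ′ *_) (sym (toVec-edge x a b)))))
    (λ v a′ → trans (toVec-copy (act x) v a′) (trans (onCopy-eq v a′) (cong (λ′ *_) (sym (toVec-copy x v a′)))))
    where open IsEigenvector eigen

  incidence-transpose-lft : ∀ (u : Fin VV → ℤ) x →
    incidence (λ a b → u (lft a) + u (rgt b)) (lft x) ≡ + p * u (lft x) + sumFin (λ b → u (rgt b))
  incidence-transpose-lft u x = trans (incidence-lft (λ a b → u (lft a) + u (rgt b)) x)
    (trans (sumFin-+ (λ _ → u (lft x)) (λ b → u (rgt b))) (cong (_+ sumFin (λ b → u (rgt b))) (sumFin-const {p} (u (lft x)))))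

  incidence-transpose-rgt : ∀ (u : Fin VV → ℤ) y →
    incidence (λ a b → u (lft a) + u (rgt b)) (rgt y) ≡ sumFin (λ a → u (lft a)) + + p * u (rgt y)
  incidence-transpose-rgt u y = trans (incidence-rgt (λ a b → u (lft a) + u (rgt b)) y)
    (trans (sumFin-+ (λ a → u (lft a)) (λ _ → u (rgt y))) (cong (_+_ (sumFin (λ a → u (lft a)))) (sumFin-const {p} (u (rgt y)))))

  ·-comm : ∀ x y → x · y ≡ y · x
  ·-comm x y = cong₂ _+_ (cong₂ _+_ (sumFin-cong λ v → *-comm (onVertex x v) (onVertex y v))
                                   (sumFin-cong λ a → sumFin-cong λ b → *-comm (onEdge x a b) (onEdge y a b)))
                         (sumFin-cong λ v → sumFin-cong λ a′ → *-comm (onCopy x v a′) (onCopy y v a′))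

  sign : Fin p → ℤ
  sign zero    = - + 1
  sign (suc _) = + 1

  -- Helmert vectors on each side of K_{p,p}, glued into eigenvectors of the signless Laplacian R Rᵀ
  -- (R the vertex–edge incidence matrix).
  laplacianVecˡ laplacianVecʳ : Fin p → Fin VV → ℤ
  laplacianVecˡ a = sides (helmert a) (λ _ → δ a zero)
  laplacianVecʳ b = sides (λ _ → δ b zero) (λ y → sign b * helmert b y)

  laplacianVec : Fin VV → Fin VV → ℤ
  laplacianVec = sides laplacianVecˡ laplacianVecʳ

  laplacianValˡ laplacianValʳ : Fin p → ℤ
  laplacianValˡ zero    = + (p ℕ.+ p)
  laplacianValˡ (suc _) = + p
  laplacianValʳ zero    = + 0
  laplacianValʳ (suc _) = + p

  laplacianVal : Fin VV → ℤ
  laplacianVal = sides laplacianValˡ laplacianValʳ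

  laplacianVec-ll : ∀ a x → laplacianVec (lft a) (lft x) ≡ helmert a x
  laplacianVec-ll a x = trans (cong (λ f → f (lft x)) (sides-lft laplacianVecˡ laplacianVecʳ a)) (sides-lft (helmert a) _ x)

  laplacianVec-lr : ∀ a y → laplacianVec (lft a) (rgt y) ≡ δ a zero
  laplacianVec-lr a y = trans (cong (λ f → f (rgt y)) (sides-lft laplacianVecˡ laplacianVecʳ a)) (sides-rgt (helmert a) _ y)

  laplacianVec-rl : ∀ b x → laplacianVec (rgt b) (lft x) ≡ δ b zero
  laplacianVec-rl b x =
    trans (cong (λ f → f (lft x)) (sides-rgt laplacianVecˡ laplacianVecʳ b)) (sides-lft _ (λ y → sign b * helmert b y) x)

  laplacianVec-rr : ∀ b y → laplacianVec (rgt b) (rgt y) ≡ sign b * helmert b y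
  laplacianVec-rr b y = trans (cong (λ f → f (rgt y)) (sides-rgt laplacianVecˡ laplacianVecʳ b)) (sides-rgt (λ _ → δ b zero) _ y)

  private
    Rᵀ : (Fin VV → ℤ) → Fin p → Fin p → ℤ
    Rᵀ u a b = u (lft a) + u (rgt b)

  laplacianVec-eigen : ∀ i v → incidence (Rᵀ (laplacianVec i)) v ≡ laplacianVal i * laplacianVec i v
  laplacianVec-eigen = side-elim _ (λ a → side-elim _ (ll a) (lr a)) (λ b → side-elim _ (rl b) (rr b))
    where
    P : ℤ
    P = + p
    twice : ∀ P → P * + 1 + P * + 1 ≡ (P + P) * + 1
    twice = solve-∀

    ll : ∀ a x → incidence (Rᵀ (laplacianVec (lft a))) (lft x) ≡ laplacianVal (lft a) * laplacianVec (lft a) (lft x)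
    ll a x = trans (incidence-transpose-lft (laplacianVec (lft a)) x)
      (trans (cong₂ (λ h s → P * h + s) (laplacianVec-ll a x) (trans (sumFin-cong (laplacianVec-lr a)) (sumFin-const {p} (δ a zero))))
      (trans (by-case a) (sym (cong₂ _*_ (sides-lft laplacianValˡ laplacianValʳ a) (laplacianVec-ll a x)))))
      where
      by-case : ∀ a → P * helmert a x + P * δ a zero ≡ laplacianValˡ a * helmert a x
      by-case zero    = twice P
      by-case (suc h) = trans (cong (_+_ (P * helmert (suc h) x)) (*-zeroʳ P)) (+-identityʳ _)

    lr : ∀ a y → incidence (Rᵀ (laplacianVec (lft a))) (rgt y) ≡ laplacianVal (lft a) * laplacianVec (lft a) (rgt y)
    lr a y = trans (incidence-transpose-rgt (laplacianVec (lft a)) y)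
      (trans (cong₂ (λ s h → s + P * h) (trans (sumFin-cong (laplacianVec-ll a)) (sumFin-helmert a)) (laplacianVec-lr a y))
      (trans (by-case a) (sym (cong₂ _*_ (sides-lft laplacianValˡ laplacianValʳ a) (laplacianVec-lr a y)))))
      where
      by-case : ∀ a → P * δ a zero + P * δ a zero ≡ laplacianValˡ a * δ a zero
      by-case zero    = twice P
      by-case (suc h) = trans (cong₂ _+_ (*-zeroʳ P) (*-zeroʳ P)) (sym (*-zeroʳ P))

    rl : ∀ b x → incidence (Rᵀ (laplacianVec (rgt b))) (lft x) ≡ laplacianVal (rgt b) * laplacianVec (rgt b) (lft x)
    rl b x = trans (incidence-transpose-lft (laplacianVec (rgt b)) x)
      (trans (cong₂ (λ d s → P * d + s) (laplacianVec-rl b x)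
                    (trans (sumFin-cong (laplacianVec-rr b))
                           (trans (sumFin-*ˡ (sign b) (helmert b)) (cong (sign b *_) (sumFin-helmert b)))))
      (trans (by-case b) (sym (cong₂ _*_ (sides-rgt laplacianValˡ laplacianValʳ b) (laplacianVec-rl b x)))))
      where
      by-case : ∀ b → P * δ b zero + sign b * (P * δ b zero) ≡ laplacianValʳ b * δ b zero
      by-case zero    = cancel P
        where
        cancel : ∀ P → P * + 1 + (- + 1) * (P * + 1) ≡ + 0 * + 1
        cancel = solve-∀
      by-case (suc h) = trans (cong₂ (λ x y → x + + 1 * y) (*-zeroʳ P) (*-zeroʳ P)) (sym (*-zeroʳ P))

    rr : ∀ b y → incidence (Rᵀ (laplacianVec (rgt b))) (rgt y) ≡ laplacianVal (rgt b) * laplacianVec (rgt b) (rgt y)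
    rr b y = trans (incidence-transpose-rgt (laplacianVec (rgt b)) y)
      (trans (cong₂ (λ s h → s + P * h) (trans (sumFin-cong (laplacianVec-rl b)) (sumFin-const {p} (δ b zero))) (laplacianVec-rr b y))
      (trans (by-case b) (sym (cong₂ _*_ (sides-rgt laplacianValˡ laplacianValʳ b) (laplacianVec-rr b y)))))
      where
      by-case : ∀ b → P * δ b zero + P * (sign b * helmert b y) ≡ laplacianValʳ b * (sign b * helmert b y)
      by-case zero    = cancel P
        where
        cancel : ∀ P → P * + 1 + P * ((- + 1) * + 1) ≡ + 0 * ((- + 1) * + 1)
        cancel = solve-∀
      by-case (suc h) = trans (cong (_+ P * (+ 1 * helmert (suc h) y)) (*-zeroʳ P)) (+-identityˡ _)

  laplacianVec-orthogonal : ∀ i j → i ≢ j → sumFin (λ v → laplacianVec i v * laplacianVec j v) ≡ + 0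
  laplacianVec-orthogonal = side-elim _ (λ a → side-elim _ (ll a) (lr a)) (λ b → side-elim _ (rl b) (rr b))
    where
    P : ℤ
    P = + p
    ll : ∀ a a′ → lft a ≢ lft a′ → sumFin (λ v → laplacianVec (lft a) v * laplacianVec (lft a′) v) ≡ + 0
    ll a a′ a≢a′ = trans (sumFin-VV (λ v → laplacianVec (lft a) v * laplacianVec (lft a′) v)) (trans (cong₂ _+_
      (trans (sumFin-cong λ x → cong₂ _*_ (laplacianVec-ll a x) (laplacianVec-ll a′ x))
             (helmert-orthogonal a a′ (a≢a′ ∘ cong lft)))
      (trans (sumFin-cong λ y → cong₂ _*_ (laplacianVec-lr a y) (laplacianVec-lr a′ y))
             (trans (sumFin-const {p} (δ a zero * δ a′ zero))
                    (trans (cong (P *_) (δ-both-zero (a≢a′ ∘ cong lft))) (*-zeroʳ P)))))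
      (+-identityˡ (+ 0)))

    lr : ∀ a b → lft a ≢ rgt b → sumFin (λ v → laplacianVec (lft a) v * laplacianVec (rgt b) v) ≡ + 0
    lr a b _ = trans (sumFin-VV (λ v → laplacianVec (lft a) v * laplacianVec (rgt b) v)) (trans (cong₂ _+_
      (trans (sumFin-cong λ x → cong₂ _*_ (laplacianVec-ll a x) (laplacianVec-rl b x))
             (trans (sumFin-*ʳ (helmert a) (δ b zero)) (cong (_* δ b zero) (sumFin-helmert a))))
      (trans (sumFin-cong λ y → cong₂ _*_ (laplacianVec-lr a y) (laplacianVec-rr b y))
             (trans (sumFin-*ˡ (δ a zero) (λ y → sign b * helmert b y))
                    (cong (δ a zero *_) (trans (sumFin-*ˡ (sign b) (helmert b)) (cong (sign b *_) (sumFin-helmert b)))))))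
      (trans (factor P (δ a zero) (δ b zero) (sign b)) (trans (cong (P * δ a zero *_) (cancels b)) (*-zeroʳ (P * δ a zero)))))
      where
      factor : ∀ P d e s → (P * d) * e + d * (s * (P * e)) ≡ (P * d) * (e * (+ 1 + s))
      factor = solve-∀
      cancels : ∀ b → δ b zero * (+ 1 + sign b) ≡ + 0
      cancels zero    = refl
      cancels (suc _) = refl

    rl : ∀ b a → rgt b ≢ lft a → sumFin (λ v → laplacianVec (rgt b) v * laplacianVec (lft a) v) ≡ + 0
    rl b a b≢a = trans (sumFin-cong λ v → *-comm (laplacianVec (rgt b) v) (laplacianVec (lft a) v)) (lr a b (b≢a ∘ sym))

    rr : ∀ b b′ → rgt b ≢ rgt b′ → sumFin (λ v → laplacianVec (rgt b) v * laplacianVec (rgt b′) v) ≡ + 0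
    rr b b′ b≢b′ = trans (sumFin-VV (λ v → laplacianVec (rgt b) v * laplacianVec (rgt b′) v)) (trans (cong₂ _+_
      (trans (sumFin-cong λ x → cong₂ _*_ (laplacianVec-rl b x) (laplacianVec-rl b′ x))
             (trans (sumFin-const {p} (δ b zero * δ b′ zero))
                    (trans (cong (P *_) (δ-both-zero (b≢b′ ∘ cong rgt))) (*-zeroʳ P))))
      (trans (sumFin-cong λ y → trans (cong₂ _*_ (laplacianVec-rr b y) (laplacianVec-rr b′ y))
                                      (interchange (sign b) (helmert b y) (sign b′) (helmert b′ y)))
             (trans (sumFin-*ˡ (sign b * sign b′) (λ y → helmert b y * helmert b′ y))
                    (trans (cong (sign b * sign b′ *_) (helmert-orthogonal b b′ (b≢b′ ∘ cong rgt)))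
                           (*-zeroʳ (sign b * sign b′))))))
      (+-identityˡ (+ 0)))
      where
      interchange : ∀ s h s′ h′ → (s * h) * (s′ * h′) ≡ (s * s′) * (h * h′)
      interchange = solve-∀

  laplacianVec-nonzero : ∀ i → ∃ λ v → laplacianVec i v ≢ + 0
  laplacianVec-nonzero = side-elim _
    (λ a → lft zero , λ eq → one≢zero (trans (sym (trans (laplacianVec-ll a zero) (helmert-zero a))) eq))
    (λ b → rgt zero , λ eq → sign≢0 b (trans (sym (trans (laplacianVec-rr b zero)
                                       (trans (cong (sign b *_) (helmert-zero b)) (*-identityʳ (sign b))))) eq))
    where
    one≢zero : + 1 ≢ + 0
    one≢zero ()
    sign≢0 : ∀ b → sign b ≢ + 0
    sign≢0 zero    ()
    sign≢0 (suc _) ()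

  module WithRoots (k : Fin VV → ℤ) (k²≡ : ∀ i → k i * k i ≡ + q + laplacianVal i) where

    W : Fin VV → ℤ → BlockVec
    W i ε = ⟨ (λ v → (ε * k i) * laplacianVec i v) , Rᵀ (laplacianVec i) , (λ v _ → laplacianVec i v) ⟩

    W-eigen : ∀ i ε → ε * ε ≡ + 1 → IsEigenvector (W i ε) (ε * k i)
    W-eigen i ε ε²≡1 = record
      { onVertex-eq = λ v → trans (cong₂ _+_ (laplacianVec-eigen i v) (sumFin-const {q} (laplacianVec i v)))
                                  (rescale (laplacianVec i v))
      ; onEdge-eq   = λ a b → sym (*-distribˡ-+ (ε * k i) (laplacianVec i (lft a)) (laplacianVec i (rgt b)))
      ; onCopy-eq   = λ v a′ → refl
      }
      where
      rescale : ∀ w → laplacianVal i * w + + q * w ≡ (ε * k i) * ((ε * k i) * w)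
      rescale w = begin
        laplacianVal i * w + + q * w   ≡⟨ collect (laplacianVal i) (+ q) w ⟩
        (+ q + laplacianVal i) * w     ≡⟨ cong (_* w) (k²≡ i) ⟨
        (k i * k i) * w                ≡⟨ cong (_* w) (*-identityˡ (k i * k i)) ⟨
        (+ 1 * (k i * k i)) * w        ≡⟨ cong (λ e → (e * (k i * k i)) * w) ε²≡1 ⟨
        ((ε * ε) * (k i * k i)) * w    ≡⟨ regroup ε (k i) w ⟩
        (ε * k i) * ((ε * k i) * w)    ∎
        where
        open ≡-Reasoning
        collect : ∀ μ q w → μ * w + q * w ≡ (q + μ) * w
        collect = solve-∀
        regroup : ∀ e k w → ((e * e) * (k * k)) * w ≡ (e * k) * ((e * k) * w)
        regroup = solve-∀

    W-· : ∀ i ε s → W i ε · s ≡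
      sumFin (λ v → ((ε * k i) * laplacianVec i v) * onVertex s v) + sumFin (λ v → laplacianVec i v * onVertex (act s) v)
    W-· i ε s = trans (+-assoc vertexPart edgePart copyPart) (cong (_+_ vertexPart) (begin
      edgePart + copyPart
        ≡⟨ cong₂ _+_ (incidence-adjoint w (onEdge s)) (sumFin-cong λ v → sumFin-*ˡ (w v) (onCopy s v)) ⟩
      sumFin (λ v → w v * incidence (onEdge s) v) + sumFin (λ v → w v * sumFin (onCopy s v))
        ≡⟨ sumFin-+ (λ v → w v * incidence (onEdge s) v) (λ v → w v * sumFin (onCopy s v)) ⟨
      sumFin (λ v → w v * incidence (onEdge s) v + w v * sumFin (onCopy s v))
        ≡⟨ sumFin-cong (λ v → *-distribˡ-+ (w v) (incidence (onEdge s) v) (sumFin (onCopy s v))) ⟨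
      sumFin (λ v → w v * onVertex (act s) v) ∎))
      where
      open ≡-Reasoning
      w : Fin VV → ℤ
      w = laplacianVec i
      vertexPart edgePart copyPart : ℤ
      vertexPart = sumFin (λ v → ((ε * k i) * w v) * onVertex s v)
      edgePart   = sumFin (λ a → sumFin (λ b → Rᵀ w a b * onEdge s a b))
      copyPart   = sumFin (λ v → sumFin (λ a′ → w v * onCopy s v a′))

    W-coefficient : Fin VV → ℤ → Fin VV → ℤ → ℤ
    W-coefficient i ε j ε′ = (ε * k i) * (ε′ * k j) + (laplacianVal j + + q)

    W-·-W : ∀ i ε j ε′ → W i ε · W j ε′ ≡ W-coefficient i ε j ε′ * sumFin (λ v → laplacianVec i v * laplacianVec j v)
    W-·-W i ε j ε′ = begin
      W i ε · W j ε′
        ≡⟨ W-· i ε (W j ε′) ⟩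
      sumFin (λ v → (c * laplacianVec i v) * (c′ * laplacianVec j v))
      + sumFin (λ v → laplacianVec i v * onVertex (act (W j ε′)) v)
        ≡⟨ cong₂ _+_ (sumFin-cong λ v → interchange c (laplacianVec i v) c′ (laplacianVec j v))
                     (sumFin-cong λ v → trans (cong (laplacianVec i v *_)
                                                    (cong₂ _+_ (laplacianVec-eigen j v) (sumFin-const {q} (laplacianVec j v))))
                                              (pull-out (laplacianVec i v) (laplacianVal j) (+ q) (laplacianVec j v))) ⟩
      sumFin (λ v → (c * c′) * ⟨w⟩ v) + sumFin (λ v → (laplacianVal j + + q) * ⟨w⟩ v)
        ≡⟨ cong₂ _+_ (sumFin-*ˡ (c * c′) ⟨w⟩) (sumFin-*ˡ (laplacianVal j + + q) ⟨w⟩) ⟩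
      (c * c′) * sumFin ⟨w⟩ + (laplacianVal j + + q) * sumFin ⟨w⟩
        ≡⟨ *-distribʳ-+ (sumFin ⟨w⟩) (c * c′) (laplacianVal j + + q) ⟨
      (c * c′ + (laplacianVal j + + q)) * sumFin ⟨w⟩ ∎
      where
      open ≡-Reasoning
      c c′ : ℤ
      c = ε * k i
      c′ = ε′ * k j
      ⟨w⟩ : Fin VV → ℤ
      ⟨w⟩ v = laplacianVec i v * laplacianVec j v
      interchange : ∀ a x b y → (a * x) * (b * y) ≡ (a * b) * (x * y)
      interchange = solve-∀
      pull-out : ∀ x μ q y → x * (μ * y + q * y) ≡ (μ + q) * (x * y)
      pull-out = solve-∀

    Q : Fin VV → Fin q′ → BlockVec
    Q i h = ⟨ (λ _ → + 0) , (λ _ _ → + 0) , (λ v a′ → δ v i * helmert (suc h) a′) ⟩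

    Q-eigen : ∀ i h → IsEigenvector (Q i h) (+ 0)
    Q-eigen i h = record
      { onVertex-eq = λ v → cong₂ _+_ (sumFin-zero λ a → sumFin-zero λ b → *-zeroʳ (δ v (lft a) + δ v (rgt b)))
          (trans (sumFin-*ˡ (δ v i) (helmert (suc h))) (trans (cong (δ v i *_) (sumFin-helmert-suc h)) (*-zeroʳ (δ v i))))
      ; onEdge-eq   = λ _ _ → refl
      ; onCopy-eq   = λ _ _ → refl
      }

    Q-·-Q : ∀ i h j h′ → Q i h · Q j h′ ≡ δ i j * sumFin (λ a′ → helmert (suc h) a′ * helmert (suc h′) a′)
    Q-·-Q i h j h′ = trans
      (cong₂ _+_ (cong₂ _+_ (sumFin-zero {VV} (λ _ → refl)) (sumFin-zero {p} λ a → sumFin-zero {p} λ _ → refl))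
      (trans (sumFin-cong λ v → trans (sumFin-cong λ a′ → interchange (δ v i) (helmert (suc h) a′)
                                                                      (δ v j) (helmert (suc h′) a′))
                                      (sumFin-*ˡ (δ v i * δ v j) (λ a′ → helmert (suc h) a′ * helmert (suc h′) a′)))
      (trans (sumFin-cong λ v → *-assoc (δ v i) (δ v j) D) (sumFin-δˡ i (λ v → δ v j * D)))))
      (+-identityˡ (δ i j * D))
      where
      D : ℤ
      D = sumFin (λ a′ → helmert (suc h) a′ * helmert (suc h′) a′)
      interchange : ∀ d x e y → (d * x) * (e * y) ≡ (d * e) * (x * y)
      interchange = solve-∀

    -- The copy part of E a b is chosen so that the vertex rows of A · E a b cancel.
    Ecopyˡ Ecopyʳ : Fin p → Fin p → Fin p → ℤ
    Ecopyˡ a b x = - (+ p * (δ b zero * helmert a x))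
    Ecopyʳ a b y = - (+ p * (δ a zero * helmert b y))

    Ecopy : Fin p → Fin p → Fin VV → ℤ
    Ecopy a b = sides (Ecopyˡ a b) (Ecopyʳ a b)

    E : Fin p → Fin p → BlockVec
    E a b = ⟨ (λ _ → + 0) , (λ x y → + q * (helmert a x * helmert b y)) , (λ v _ → Ecopy a b v) ⟩

    E-eigen : ∀ a b → IsEigenvector (E a b) (+ 0)
    E-eigen a b = record
      { onVertex-eq = side-elim _ at-lft at-rgt
      ; onEdge-eq   = λ _ _ → refl
      ; onCopy-eq   = λ _ _ → refl
      }
      where
      at-lft : ∀ x → incidence (onEdge (E a b)) (lft x) + sumFin {q} (λ _ → Ecopy a b (lft x)) ≡ + 0 * + 0
      at-lft x = trans (cong₂ _+_
        (trans (incidence-lft (onEdge (E a b)) x) (trans (sumFin-*ˡ (+ q) (λ y → helmert a x * helmert b y))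
               (cong (+ q *_) (trans (sumFin-*ˡ (helmert a x) (helmert b)) (cong (helmert a x *_) (sumFin-helmert b))))))
        (trans (sumFin-const {q} (Ecopy a b (lft x))) (cong (+ q *_) (sides-lft (Ecopyˡ a b) (Ecopyʳ a b) x))))
        (cancel (+ q) (+ p) (helmert a x) (δ b zero))
        where
        cancel : ∀ q p h d → q * (h * (p * d)) + q * (- (p * (d * h))) ≡ + 0 * + 0
        cancel = solve-∀
      at-rgt : ∀ y → incidence (onEdge (E a b)) (rgt y) + sumFin {q} (λ _ → Ecopy a b (rgt y)) ≡ + 0 * + 0
      at-rgt y = trans (cong₂ _+_
        (trans (incidence-rgt (onEdge (E a b)) y) (trans (sumFin-*ˡ (+ q) (λ x → helmert a x * helmert b y))
               (cong (+ q *_) (trans (sumFin-*ʳ (helmert a) (helmert b y)) (cong (_* helmert b y) (sumFin-helmert a))))))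
        (trans (sumFin-const {q} (Ecopy a b (rgt y))) (cong (+ q *_) (sides-rgt (Ecopyˡ a b) (Ecopyʳ a b) y))))
        (cancel (+ q) (+ p) (helmert b y) (δ a zero))
        where
        cancel : ∀ q p h d → q * ((p * d) * h) + q * (- (p * (d * h))) ≡ + 0 * + 0
        cancel = solve-∀

    Q-·-E : ∀ i h a b → Q i h · E a b ≡ + 0
    Q-·-E i h a b = cong₂ _+_ (cong₂ _+_ (sumFin-zero {VV} (λ _ → refl)) (sumFin-zero {p} λ _ → sumFin-zero {p} λ _ → refl))
                              (sumFin-zero copy-part)
      where
      copy-part : ∀ v → sumFin (λ a′ → (δ v i * helmert (suc h) a′) * Ecopy a b v) ≡ + 0
      copy-part v = trans (sumFin-*ʳ (λ a′ → δ v i * helmert (suc h) a′) (Ecopy a b v))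
        (cong (_* Ecopy a b v) (trans (sumFin-*ˡ (δ v i) (helmert (suc h)))
                                      (trans (cong (δ v i *_) (sumFin-helmert-suc h)) (*-zeroʳ (δ v i)))))

    helmertDot : Fin p → Fin p → ℤ
    helmertDot a a′ = sumFin (λ x → helmert a x * helmert a′ x)

    E-·-E : ∀ a b a′ b′ → E a b · E a′ b′ ≡
      (+ q * + q) * (helmertDot a a′ * helmertDot b b′)
      + + q * ((+ p * + p) * ((δ b zero * δ b′ zero) * helmertDot a a′)
              + (+ p * + p) * ((δ a zero * δ a′ zero) * helmertDot b b′))
    E-·-E a b a′ b′ =
      cong₂ _+_ (trans (cong (_+ edgeSum) (sumFin-zero {VV} (λ _ → refl))) (trans (+-identityˡ edgeSum) edge-part)) copy-part
      where
      Q² P² edgeSum : ℤ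
      Q² = + q * + q
      P² = + p * + p
      edgeSum = sumFin (λ x → sumFin (λ y → (+ q * (helmert a x * helmert b y)) * (+ q * (helmert a′ x * helmert b′ y))))
      edge-part : edgeSum ≡ Q² * (helmertDot a a′ * helmertDot b b′)
      edge-part = begin
        sumFin (λ x → sumFin (λ y → (+ q * (helmert a x * helmert b y)) * (+ q * (helmert a′ x * helmert b′ y))))
          ≡⟨ sumFin-cong (λ x → trans (sumFin-cong λ y → regroup (+ q) (helmert a x) (helmert b y)
                                                                   (helmert a′ x) (helmert b′ y))
                                      (sumFin-*ˡ (Q² * (helmert a x * helmert a′ x)) (λ y → helmert b y * helmert b′ y))) ⟩
        sumFin (λ x → (Q² * (helmert a x * helmert a′ x)) * helmertDot b b′)
          ≡⟨ sumFin-*ʳ (λ x → Q² * (helmert a x * helmert a′ x)) (helmertDot b b′) ⟩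
        sumFin (λ x → Q² * (helmert a x * helmert a′ x)) * helmertDot b b′
          ≡⟨ cong (_* helmertDot b b′) (sumFin-*ˡ Q² (λ x → helmert a x * helmert a′ x)) ⟩
        (Q² * helmertDot a a′) * helmertDot b b′
          ≡⟨ *-assoc Q² (helmertDot a a′) (helmertDot b b′) ⟩
        Q² * (helmertDot a a′ * helmertDot b b′) ∎
        where
        open ≡-Reasoning
        regroup : ∀ q x y x′ y′ → (q * (x * y)) * (q * (x′ * y′)) ≡ ((q * q) * (x * x′)) * (y * y′)
        regroup = solve-∀
      side : ∀ (d d′ : ℤ) (f f′ : Fin p → ℤ) → sumFin (λ x → (- (+ p * (d * f x))) * (- (+ p * (d′ * f′ x))))
           ≡ P² * ((d * d′) * sumFin (λ x → f x * f′ x))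
      side d d′ f f′ = trans (sumFin-cong λ x → regroup (+ p) d d′ (f x) (f′ x))
        (trans (sumFin-*ˡ (P² * (d * d′)) (λ x → f x * f′ x)) (*-assoc P² (d * d′) _))
        where
        regroup : ∀ p d d′ x x′ → (- (p * (d * x))) * (- (p * (d′ * x′))) ≡ (p * p * (d * d′)) * (x * x′)
        regroup = solve-∀
      copy-part : sumFin (λ v → sumFin {q} (λ _ → Ecopy a b v * Ecopy a′ b′ v))
                ≡ + q * (P² * ((δ b zero * δ b′ zero) * helmertDot a a′) + P² * ((δ a zero * δ a′ zero) * helmertDot b b′))
      copy-part = trans (sumFin-cong λ v → sumFin-const {q} (Ecopy a b v * Ecopy a′ b′ v))
        (trans (sumFin-*ˡ (+ q) (λ v → Ecopy a b v * Ecopy a′ b′ v))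
        (cong (+ q *_) (trans (sumFin-VV (λ v → Ecopy a b v * Ecopy a′ b′ v)) (cong₂ _+_
          (trans (sumFin-cong λ x → cong₂ _*_ (sides-lft (Ecopyˡ a b) (Ecopyʳ a b) x)
                                             (sides-lft (Ecopyˡ a′ b′) (Ecopyʳ a′ b′) x))
                 (side (δ b zero) (δ b′ zero) (helmert a) (helmert a′)))
          (trans (sumFin-cong λ y → cong₂ _*_ (sides-rgt (Ecopyˡ a b) (Ecopyʳ a b) y)
                                             (sides-rgt (Ecopyˡ a′ b′) (Ecopyʳ a′ b′) y))
                 (side (δ a zero) (δ a′ zero) (helmert b) (helmert b′)))))))

    E-·-E-orthogonal : ∀ a b a′ b′ → (a ≢ a′ ⊎ b ≢ b′) → E a b · E a′ b′ ≡ + 0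
    E-·-E-orthogonal a b a′ b′ (inj₁ a≢a′) = trans (E-·-E a b a′ b′) (trans
      (cong₂ (λ h d → (+ q * + q) * (h * helmertDot b b′)
                      + + q * ((+ p * + p) * ((δ b zero * δ b′ zero) * h) + (+ p * + p) * (d * helmertDot b b′)))
             (helmert-orthogonal a a′ a≢a′) (δ-both-zero a≢a′))
      (vanishes (+ q) (+ p) (helmertDot b b′) (δ b zero * δ b′ zero)))
      where
      vanishes : ∀ q p y d → (q * q) * (+ 0 * y) + q * ((p * p) * (d * + 0) + (p * p) * (+ 0 * y)) ≡ + 0
      vanishes = solve-∀
    E-·-E-orthogonal a b a′ b′ (inj₂ b≢b′) = trans (E-·-E a b a′ b′) (trans
      (cong₂ (λ h d → (+ q * + q) * (helmertDot a a′ * h)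
                      + + q * ((+ p * + p) * (d * helmertDot a a′) + (+ p * + p) * ((δ a zero * δ a′ zero) * h)))
             (helmert-orthogonal b b′ b≢b′) (δ-both-zero b≢b′))
      (vanishes (+ q) (+ p) (helmertDot a a′) (δ a zero * δ a′ zero)))
      where
      vanishes : ∀ q p x d → (q * q) * (x * + 0) + q * ((p * p) * (+ 0 * x) + (p * p) * (d * + 0)) ≡ + 0
      vanishes = solve-∀

    W-·-W-distinct : ∀ {i j} ε ε′ → i ≢ j → W i ε · W j ε′ ≡ + 0
    W-·-W-distinct {i} {j} ε ε′ i≢j =
      trans (W-·-W i ε j ε′)
            (trans (cong (W-coefficient i ε j ε′ *_) (laplacianVec-orthogonal i j i≢j)) (*-zeroʳ (W-coefficient i ε j ε′)))

    W-·-W-opposite : ∀ i ε ε′ → ε * ε′ ≡ - + 1 → W i ε · W i ε′ ≡ + 0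
    W-·-W-opposite i ε ε′ εε′≡-1 =
      trans (W-·-W i ε i ε′) (cong (_* sumFin (λ v → laplacianVec i v * laplacianVec i v)) coefficient≡0)
      where
      coefficient≡0 : W-coefficient i ε i ε′ ≡ + 0
      coefficient≡0 = begin
        (ε * k i) * (ε′ * k i) + (laplacianVal i + + q)
          ≡⟨ regroup ε ε′ (k i) (laplacianVal i) (+ q) ⟩
        (ε * ε′) * (k i * k i) + (laplacianVal i + + q)
          ≡⟨ cong₂ (λ s t → s * t + (laplacianVal i + + q)) εε′≡-1 (k²≡ i) ⟩
        (- + 1) * (+ q + laplacianVal i) + (laplacianVal i + + q)
          ≡⟨ cancel (+ q) (laplacianVal i) ⟩
        + 0 ∎
        where
        open ≡-Reasoning
        regroup : ∀ e e′ k μ q → (e * k) * (e′ * k) + (μ + q) ≡ (e * e′) * (k * k) + (μ + q)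
        regroup = solve-∀
        cancel : ∀ q μ → (- + 1) * (q + μ) + (μ + q) ≡ + 0
        cancel = solve-∀

    W-·-null : ∀ i ε s → IsEigenvector s (+ 0) → (∀ v → onVertex s v ≡ + 0) → W i ε · s ≡ + 0
    W-·-null i ε s eigen s≡0 = trans (W-· i ε s) (cong₂ _+_
      (sumFin-zero λ v → trans (cong (((ε * k i) * laplacianVec i v) *_) (s≡0 v)) (*-zeroʳ ((ε * k i) * laplacianVec i v)))
      (sumFin-zero λ v → trans (cong (laplacianVec i v *_) (IsEigenvector.onVertex-eq eigen v)) (*-zeroʳ (laplacianVec i v))))

    -- Labels of the eigenbasis: plus/minus i carry the eigenvalues ± k i; edgeMode labels eigenvalue-0
    -- vectors supported on subdivision vertices and copies, copyMode those inside a single copy.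
    data Mode : Set where
      plus minus : Fin VV → Mode
      edgeMode   : Fin p → Fin p → Mode
      copyMode   : Fin VV → Fin q′ → Mode

    vec : Mode → BlockVec
    vec (plus i)       = W i (+ 1)
    vec (minus i)      = W i (- + 1)
    vec (edgeMode a b) = E a b
    vec (copyMode i h) = Q i h

    eigenvalue : Mode → ℤ
    eigenvalue (plus i)       = + 1 * k i
    eigenvalue (minus i)      = (- + 1) * k i
    eigenvalue (edgeMode _ _) = + 0
    eigenvalue (copyMode _ _) = + 0

    vec-eigen : ∀ m → IsEigenvector (vec m) (eigenvalue m)
    vec-eigen (plus i)       = W-eigen i (+ 1) refl
    vec-eigen (minus i)      = W-eigen i (- + 1) refl
    vec-eigen (edgeMode a b) = E-eigen a b
    vec-eigen (copyMode i h) = Q-eigen i h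

    vec-orthogonal : ∀ m m′ → m ≢ m′ → vec m · vec m′ ≡ + 0
    vec-orthogonal (plus i)       (plus j)         i≢j = W-·-W-distinct (+ 1) (+ 1) (i≢j ∘ cong plus)
    vec-orthogonal (plus i)       (minus j)        _   with i ≟ j
    ... | yes refl = W-·-W-opposite i (+ 1) (- + 1) refl
    ... | no i≢j   = W-·-W-distinct (+ 1) (- + 1) i≢j
    vec-orthogonal (minus i)      (plus j)         _   with i ≟ j
    ... | yes refl = W-·-W-opposite i (- + 1) (+ 1) refl
    ... | no i≢j   = W-·-W-distinct (- + 1) (+ 1) i≢j
    vec-orthogonal (minus i)      (minus j)        i≢j = W-·-W-distinct (- + 1) (- + 1) (i≢j ∘ cong minus)
    vec-orthogonal (plus i)       (edgeMode a b)   _   = W-·-null i (+ 1) (E a b) (E-eigen a b) (λ _ → refl)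
    vec-orthogonal (minus i)      (edgeMode a b)   _   = W-·-null i (- + 1) (E a b) (E-eigen a b) (λ _ → refl)
    vec-orthogonal (plus i)       (copyMode j h)   _   = W-·-null i (+ 1) (Q j h) (Q-eigen j h) (λ _ → refl)
    vec-orthogonal (minus i)      (copyMode j h)   _   = W-·-null i (- + 1) (Q j h) (Q-eigen j h) (λ _ → refl)
    vec-orthogonal (edgeMode a b) (plus i)         _   = trans (·-comm (E a b) (W i (+ 1))) (vec-orthogonal (plus i) (edgeMode a b) λ ())
    vec-orthogonal (edgeMode a b) (minus i)        _   = trans (·-comm (E a b) (W i (- + 1))) (vec-orthogonal (minus i) (edgeMode a b) λ ())
    vec-orthogonal (copyMode j h) (plus i)         _   = trans (·-comm (Q j h) (W i (+ 1))) (vec-orthogonal (plus i) (copyMode j h) λ ())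
    vec-orthogonal (copyMode j h) (minus i)        _   = trans (·-comm (Q j h) (W i (- + 1))) (vec-orthogonal (minus i) (copyMode j h) λ ())
    vec-orthogonal (edgeMode a b) (edgeMode a′ b′) m≢m′ with a ≟ a′
    ... | yes refl = E-·-E-orthogonal a b a b′ (inj₂ (m≢m′ ∘ cong (edgeMode a)))
    ... | no a≢a′  = E-·-E-orthogonal a b a′ b′ (inj₁ a≢a′)
    vec-orthogonal (edgeMode a b) (copyMode i h)   _   = trans (·-comm (E a b) (Q i h)) (Q-·-E i h a b)
    vec-orthogonal (copyMode i h) (edgeMode a b)   _   = Q-·-E i h a b
    vec-orthogonal (copyMode i h) (copyMode j h′) m≢m′ with i ≟ j
    ... | yes refl = trans (Q-·-Q i h i h′)
      (trans (cong (δ i i *_) (helmert-orthogonal (suc h) (suc h′) (m≢m′ ∘ cong (copyMode i) ∘ suc-injective)))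
                                                   (*-zeroʳ (δ i i)))
    ... | no i≢j   = trans (Q-·-Q i h j h′)
      (cong (_* sumFin (λ a′ → helmert (suc h) a′ * helmert (suc h′) a′)) (δ-≢ i≢j))

    vec-nonzero : ∀ m → ∃ λ u → toVec (vec m) u ≢ + 0
    vec-nonzero (plus i)  with laplacianVec-nonzero i
    ... | v , nonzero = copy v zero , nonzero ∘ trans (sym (toVec-copy (W i (+ 1)) v zero))
    vec-nonzero (minus i) with laplacianVec-nonzero i
    ... | v , nonzero = copy v zero , nonzero ∘ trans (sym (toVec-copy (W i (- + 1)) v zero))
    vec-nonzero (edgeMode a b) = edge zero zero , λ eq → q≢0 (trans (sym (trans (toVec-edge (E a b) zero zero)
      (cong (+ q *_) (cong₂ _*_ (helmert-zero a) (helmert-zero b))))) eq)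
      where
      q≢0 : + q * (+ 1 * + 1) ≢ + 0
      q≢0 ()
    vec-nonzero (copyMode i h) = copy i zero , λ eq → one≢zero (trans (sym (trans (toVec-copy (Q i h) i zero)
      (cong₂ _*_ (δ-refl i) (helmert-zero (suc h))))) eq)
      where
      one≢zero : + 1 * + 1 ≢ + 0
      one≢zero ()

    copyModeAt : Fin VV → Fin q → Mode
    copyModeAt i zero    = minus i
    copyModeAt i (suc h) = copyMode i h

    mode : Fin NN → Mode
    mode = blocks plus edgeMode copyModeAt

    position : Mode → Fin NN
    position (plus i)       = vertex i
    position (minus i)      = copy i zero
    position (edgeMode a b) = edge a b
    position (copyMode i h) = copy i (suc h)

    position-mode : ∀ u → position (mode u) ≡ u
    position-mode = index-elim _
      (λ v → cong position (blocks-vertex plus edgeMode copyModeAt v))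
      (λ a b → cong position (blocks-edge plus edgeMode copyModeAt a b))
      (λ v a′ → trans (cong position (blocks-copy plus edgeMode copyModeAt v a′)) (at-copy v a′))
      where
      at-copy : ∀ v a′ → position (copyModeAt v a′) ≡ copy v a′
      at-copy v zero    = refl
      at-copy v (suc h) = refl

    mode-injective : ∀ {u u′} → mode u ≡ mode u′ → u ≡ u′
    mode-injective {u} {u′} eq = trans (sym (position-mode u)) (trans (cong position eq) (position-mode u′))

    eigenbasis : Matrix NN
    eigenbasis u c = toVec (vec (mode c)) u

    charMatrix : ℤ → Matrix NN
    charMatrix x i j = (if eqb i j then x else + 0) - Adj i j

    corona-AIntegral : AIntegral G
    corona-AIntegral = eigenvalue ∘ mode , λ x →
      det-orthogonalEigenbasis (charMatrix x) eigenbasis (λ c → x - eigenvalue (mode c))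
                               (columns-eigen x) columns-orthogonal columns-nonzero
      where
      columns-eigen : ∀ x u c → (charMatrix x *ᴹ eigenbasis) u c
                    ≡ eigenbasis u c * (x - eigenvalue (mode c))
      columns-eigen x u c = begin
        sumFin (λ j → ((if eqb u j then x else + 0) - Adj u j) * P j)
          ≡⟨ sumFin-cong (λ j → trans (cong (λ d → (d - Adj u j) * P j) (if-eqb u j x)) (expand (δ u j) x (Adj u j) (P j))) ⟩
        sumFin (λ j → δ u j * (x * P j) + - (Adj u j * P j))
          ≡⟨ sumFin-+ (λ j → δ u j * (x * P j)) (λ j → - (Adj u j * P j)) ⟩
        sumFin (λ j → δ u j * (x * P j)) + sumFin (λ j → - (Adj u j * P j))
          ≡⟨ cong₂ _+_ (sumFin-δʳ u (λ j → x * P j)) (sumFin-neg (λ j → Adj u j * P j)) ⟩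
        x * P u + - sumFin (λ j → Adj u j * P j)
          ≡⟨ cong (λ s → x * P u + - s) (trans (Adj-action (vec (mode c)) u) (toVec-eigenvector (vec-eigen (mode c)) u)) ⟩
        x * P u + - (eigenvalue (mode c) * P u)
          ≡⟨ factor x (P u) (eigenvalue (mode c)) ⟩
        P u * (x - eigenvalue (mode c)) ∎
        where
        open ≡-Reasoning
        P : Fin NN → ℤ
        P j = eigenbasis j c
        expand : ∀ d x a y → (d * x - a) * y ≡ d * (x * y) + - (a * y)
        expand = solve-∀
        factor : ∀ x y l → x * y + - (l * y) ≡ y * (x - l)
        factor = solve-∀

      columns-orthogonal : ∀ c e → c ≢ e → (transpose eigenbasis *ᴹ eigenbasis) c e ≡ + 0
      columns-orthogonal c e c≢e =
        trans (sumFin-toVec-* (vec (mode c)) (vec (mode e))) (vec-orthogonal (mode c) (mode e) (c≢e ∘ mode-injective))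

      columns-nonzero : ∀ c → ∃ λ u → eigenbasis u c ≢ + 0
      columns-nonzero c = vec-nonzero (mode c)

  AIntegral-from-squares : ∀ r₀ r₁ r₂ →
    r₀ ℕ.* r₀ ≡ q → r₁ ℕ.* r₁ ≡ q ℕ.+ p → r₂ ℕ.* r₂ ≡ q ℕ.+ (p ℕ.+ p) → AIntegral G
  AIntegral-from-squares r₀ r₁ r₂ r₀²≡ r₁²≡ r₂²≡ = WithRoots.corona-AIntegral k k²≡
    where
    kˡ kʳ : Fin p → ℤ
    kˡ zero    = + r₂
    kˡ (suc _) = + r₁
    kʳ zero    = + r₀
    kʳ (suc _) = + r₁
    k : Fin VV → ℤ
    k = sides kˡ kʳ

    square : ∀ r {n} → r ℕ.* r ≡ n → + r * + r ≡ + n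
    square r r²≡n = trans (sym (pos-* r r)) (cong +_ r²≡n)

    k²≡ : ∀ i → k i * k i ≡ + q + laplacianVal i
    k²≡ = side-elim _
      (λ a → trans (cong (λ z → z * z) (sides-lft kˡ kʳ a))
                   (trans (left a) (cong (_+_ (+ q)) (sym (sides-lft laplacianValˡ laplacianValʳ a)))))
      (λ b → trans (cong (λ z → z * z) (sides-rgt kˡ kʳ b))
                   (trans (right b) (cong (_+_ (+ q)) (sym (sides-rgt laplacianValˡ laplacianValʳ b)))))
      where
      left : ∀ a → kˡ a * kˡ a ≡ + q + laplacianValˡ a
      left zero    = square r₂ r₂²≡
      left (suc _) = square r₁ r₁²≡
      right : ∀ b → kʳ b * kʳ b ≡ + q + laplacianValʳ b
      right zero    = trans (square r₀ r₀²≡) (sym (+-identityʳ (+ q)))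
      right (suc _) = square r₁ r₁²≡

open import Data.Nat using (_+_; _*_; _∸_; _^_; _≤_)
open import Data.Nat.Tactic.RingSolver using (solve-∀)

Kpp-corona-AIntegral : ∀ n₁ n₂ r₀ r₁ r₂ → 1 ≤ n₁ → 1 ≤ n₂ →
  r₀ * r₀ ≡ n₂ → r₁ * r₁ ≡ n₂ + n₁ → r₂ * r₂ ≡ n₂ + (n₁ + n₁) →
  AIntegral (subdivVertexCorona (completeBipartite n₁) (emptyGraph n₂))
Kpp-corona-AIntegral (suc p′) (suc q′) r₀ r₁ r₂ (s≤s z≤n) (s≤s z≤n) =
  KppCorona.AIntegral-from-squares p′ q′ r₀ r₁ r₂

-- The ring solver does not read _^_, so the identities below spell out x ^ 2 as x * (x * 1).
pred-double-square : ∀ s′ → 2 * (1 + s′) ^ 2 ∸ 1 ≡ 1 + (2 * s′ ^ 2 + 4 * s′)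
pred-double-square s′ = cong (_∸ 1) (expand s′)
  where
  expand : ∀ s′ → 2 * ((1 + s′) * ((1 + s′) * 1)) ≡ 2 + (2 * (s′ * (s′ * 1)) + 4 * s′)
  expand = solve-∀

corollary2p5 : (s t n₁ n₂ : ℕ) → 1 ≤ s → 1 ≤ t →
    n₁ ≡ 4 * s * t ^ 2 * (2 * s ^ 2 + 3 * s + 1) →
    n₂ ≡ t ^ 2 * (2 * s ^ 2 ∸ 1) ^ 2 →
    AIntegral (subdivVertexCorona (completeBipartite n₁) (emptyGraph n₂))
corollary2p5 (suc s′) (suc t′) _ _ _ _ refl refl =
  Kpp-corona-AIntegral n₁ n₂ (t * d) (t * (2 * s ^ 2 + 2 * s + 1)) (t * (2 * s ^ 2 + 4 * s + 1))
    (s≤s z≤n) (subst (1 ≤_) (cong (λ d → t ^ 2 * d ^ 2) (sym d≡)) (s≤s z≤n))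
    (square₀ t d)
    (trans (square₁ s′ t) (cong (λ d → t ^ 2 * d ^ 2 + n₁) (sym d≡)))
    (trans (square₂ s′ t) (cong (λ d → t ^ 2 * d ^ 2 + (n₁ + n₁)) (sym d≡)))
  where
  s t d n₁ n₂ : ℕ
  s = suc s′
  t = suc t′
  d = 2 * s ^ 2 ∸ 1
  n₁ = 4 * s * t ^ 2 * (2 * s ^ 2 + 3 * s + 1)
  n₂ = t ^ 2 * d ^ 2
  d≡ : d ≡ 1 + (2 * s′ ^ 2 + 4 * s′)
  d≡ = pred-double-square s′

  square₀ : ∀ t d → (t * d) * (t * d) ≡ t * (t * 1) * (d * (d * 1))
  square₀ = solve-∀
  square₁ : ∀ s′ t →
    let s = 1 + s′
        d = 1 + (2 * (s′ * (s′ * 1)) + 4 * s′)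
    in (t * (2 * (s * (s * 1)) + 2 * s + 1)) * (t * (2 * (s * (s * 1)) + 2 * s + 1))
       ≡ t * (t * 1) * (d * (d * 1)) + 4 * s * (t * (t * 1)) * (2 * (s * (s * 1)) + 3 * s + 1)
  square₁ = solve-∀
  square₂ : ∀ s′ t →
    let s  = 1 + s′
        d  = 1 + (2 * (s′ * (s′ * 1)) + 4 * s′)
        n₁ = 4 * s * (t * (t * 1)) * (2 * (s * (s * 1)) + 3 * s + 1)
    in (t * (2 * (s * (s * 1)) + 4 * s + 1)) * (t * (2 * (s * (s * 1)) + 4 * s + 1))
       ≡ t * (t * 1) * (d * (d * 1)) + (n₁ + n₁)
  square₂ = solve-∀
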